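{- For every finite graph $G$ with maximum degree $\Delta$, $$\pi'_{\operatorname{ch}}(G)\le \Delta^2+\frac{3}{2^{1/3}}\Delta^{5/3}+8\Delta^{4/3}+1.$$
   Context: A sequence $s_1\ldots s_{2k}$ ($k\ge1$) is a square if $s_i=s_{i+k}$ for all $i$; it is non-repetitive if it has no consecutive subsequence that is a square. An edge coloring of a graph is non-repetitive if the sequence of edge colors along every path is non-repetitive. A list assignment $L$ assigns to each edge a set of colors; $\pi'_{\operatorname{ch}}(G)$ (the non-repetitive choice index) is the smallest $l$ such that for every list assignment with all lists of size at least $l$ there is a non-repetitive edge coloring in which every edge $e$ receives a color from $L(e)$. -}

module Defs where

open import Data.Nat as ℕ using (ℕ; zero; suc)
open import Data.Fin using (Fin; _≟_)
open import Data.List using (List; []; _∷_; _++_; length; map; allFin)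
open import Data.Nat.ListAction using (sum)
open import Data.List.Membership.Propositional using (_∈_)
open import Data.List.Relation.Unary.Unique.Propositional using (Unique)
open import Data.Product using (Σ; _×_; _,_; proj₁; proj₂; ∃-syntax)
open import Data.Sum using (_⊎_)
open import Data.Bool using (if_then_else_; _∨_)
open import Relation.Nullary using (¬_)
open import Relation.Nullary.Decidable using (⌊_⌋)
open import Relation.Binary.PropositionalEquality using (_≡_; _≢_)
open import Data.Integer using (+_)
open import Data.Rational as ℚ using (ℚ; _/_; 0ℚ)

HasSquare : List ℕ → Set
HasSquare xs = Σ (List ℕ) λ ys → Σ (List ℕ) λ zs → Σ (List ℕ) λ ws →
  (zs ≢ []) × (xs ≡ ys ++ (zs ++ (zs ++ ws)))

NonRepetitive : List ℕ → Set
NonRepetitive xs = ¬ HasSquare xs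

record Graph : Set where
  field
    n     : ℕ
    m     : ℕ
    ends  : Fin m → Fin n × Fin n
    loopless : ∀ e → proj₁ (ends e) ≢ proj₂ (ends e)
    simple   : ∀ e e' →
      (ends e ≡ ends e' ⊎ ends e ≡ (proj₂ (ends e') , proj₁ (ends e'))) →
      e ≡ e'

module _ (G : Graph) where
  open Graph G

  Joins : Fin m → Fin n → Fin n → Set
  Joins e u v = (ends e ≡ (u , v)) ⊎ (ends e ≡ (v , u))

  data IsWalk : List (Fin n) → List (Fin m) → Set where
    single : ∀ v → IsWalk (v ∷ []) []
    step   : ∀ {u v vs es} e → Joins e u v → IsWalk (v ∷ vs) es →
             IsWalk (u ∷ v ∷ vs) (e ∷ es)

  IsPath : List (Fin n) → List (Fin m) → Set
  IsPath vs es = IsWalk vs es × Unique vs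

  incident : Fin n → Fin m → ℕ
  incident v e =
    if ⌊ proj₁ (ends e) ≟ v ⌋ ∨ ⌊ proj₂ (ends e) ≟ v ⌋ then 1 else 0

  degree : Fin n → ℕ
  degree v = sum (map (incident v) (allFin m))

  -- Δ is the maximum degree of G (Δ = 0 for the graph without vertices)
  MaxDegree : ℕ → Set
  MaxDegree Δ = (∀ v → degree v ℕ.≤ Δ) × (Δ ≡ 0 ⊎ ∃[ v ] degree v ≡ Δ)

  NonRepColoring : (Fin m → ℕ) → Set
  NonRepColoring c = ∀ vs es → IsPath vs es → NonRepetitive (map c es)

  ChoosableWith : ℕ → Set
  ChoosableWith l = (L : Fin m → List ℕ) →
    (∀ e → Unique (L e)) → (∀ e → l ℕ.≤ length (L e)) →
    ∃[ c ] ((∀ e → c e ∈ L e) × NonRepColoring c)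

-- The bound  l ≤ Δ² + (3/2^{1/3}) Δ^{5/3} + 8 Δ^{4/3} + 1  for a natural
-- number l, expressed without reals: p stands for a rational lower
-- approximation of 3·2^{-1/3}Δ^{5/3} (p ≥ 0, 2p³ ≤ 27Δ⁵) and q for one
-- of 8Δ^{4/3} (q ≥ 0, q³ ≤ 512Δ⁴).

ℕ→ℚ : ℕ → ℚ
ℕ→ℚ k = + k / 1

BelowBound : ℕ → ℕ → Set
BelowBound Δ l = Σ ℚ λ p → Σ ℚ λ q →
  (0ℚ ℚ.≤ p) × (0ℚ ℚ.≤ q) ×
  (ℕ→ℚ 2 ℚ.* (p ℚ.* p ℚ.* p) ℚ.≤ ℕ→ℚ (27 ℕ.* (Δ ℕ.^ 5))) ×
  (q ℚ.* q ℚ.* q ℚ.≤ ℕ→ℚ (512 ℕ.* (Δ ℕ.^ 4))) ×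
  (ℕ→ℚ l ℚ.≤ ℕ→ℚ (Δ ℕ.* Δ ℕ.+ 1) ℚ.+ p ℚ.+ q)

module Submission where

-- A counting argument. For a set F of edges let count F be the number of colourings
-- of F from the lists with no square along a path inside F. Adding an edge e to F multiplies
-- this number by at least c: a bad one among the count F · l extensions has a square through e,
-- say with halves of k + 1 edges, of which there are at most 2(k+1)Δ^(2k+1); and it is determined
-- by its restriction to F minus the first half, which by induction leaves at most count F / c^k
-- choices. Hence count E ≥ c^|E| > 0 once l - c ≥ Σ_k 2(k+1)Δ^(2k+1)/c^k. For c = Δ² + d the
-- series is at most 2Δc²/d², and d ≈ (4Δ⁵)^(1/3) gives the bound; the cube roots are replaced
-- by integer parts, and Δ ≤ 31 is settled by computation.

open import Defs
open import Level using (0ℓ)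
open import Data.Nat as ℕ using (ℕ; zero; suc; _+_; _*_; _∸_; _^_; _≤_; _<_; _≤ᵇ_; _≤?_; z≤n; s≤s; NonZero; >-nonZero)
open import Data.Nat.Properties hiding (_≟_)
open import Data.Nat.ListAction using (sum)
open import Data.Nat.Solver using (module +-*-Solver)
open +-*-Solver using (solve; _:=_; _:+_; _:*_; _:^_; con)
import Data.Nat.Coprimality as Coprimality
import Data.Integer as ℤ
import Data.Integer.Properties as ℤP
open import Data.Rational as ℚ using (ℚ; mkℚ; _/_; 0ℚ)
import Data.Rational.Properties as ℚP
open import Data.Fin using (Fin; zero; suc; _≟_)
open import Data.Bool as Bool using (Bool; true; false; T; if_then_else_; _∨_; _∧_; not)
open import Data.Bool.Properties using (∨-zeroʳ; ∨-identityʳ; ∧-zeroʳ; T-∧)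
open import Data.Vec using (Vec; []; _∷_; lookup; tabulate; _[_]≔_)
open import Data.Vec.Properties using (lookup∘tabulate; lookup∘update; lookup∘update′)
  renaming (∷-injectiveʳ to ∷-injectiveʳ-Vec)
open import Data.Vec.Relation.Binary.Pointwise.Extensional using (ext; Pointwise-≡⇒≡)
open import Data.List using (List; []; _∷_; _++_; [_]; length; map; concatMap; filter; reverse; take; drop; upTo; allFin)
open import Data.List.Properties using (length-++; length-map; length-reverse; length-take; length-drop; length-tabulate;
  length-upTo; unfold-reverse; reverse-involutive; reverse-++; reverse-map; ++-assoc; map-cong-local; take++drop≡id;
  ∷-injectiveˡ; ∷-injectiveʳ; ≡-dec)
open import Data.List.Membership.Propositional using (_∈_; _∉_; find; lose)
open import Data.List.Membership.Propositional.Properties using (∈-∃++; ∈-concatMap⁺; ∈-concatMap⁻; ∈-map⁺; ∈-map⁻;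
  ∈-++⁺ˡ; ∈-++⁺ʳ; ∈-++⁻; ∈-allFin; ∈-upTo⁺; ∈-upTo⁻; ∈-filter⁺; ∈-filter⁻; ∈-length)
open import Data.List.Relation.Binary.Subset.Propositional using (_⊆_)
open import Data.List.Relation.Unary.Any using (here; there)
import Data.List.Relation.Unary.Any.Properties as AnyP
open import Data.List.Relation.Unary.All as All using (All; []; _∷_)
import Data.List.Relation.Unary.All.Properties as AllP
open import Data.List.Relation.Unary.All.Properties.Core using (¬All⇒Any¬)
open import Data.List.Relation.Unary.AllPairs using ([]; _∷_)
open import Data.List.Relation.Unary.Unique.Propositional using (Unique)
import Data.List.Relation.Unary.Unique.Propositional.Properties as UniqueP
open import Data.Product using (∃; ∃₂; ∃-syntax; _×_; _,_; proj₁; proj₂; swap)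
open import Data.Sum using (_⊎_; inj₁; inj₂)
open import Data.Empty using (⊥; ⊥-elim)
open import Function.Bundles using (Equivalence)
open import Relation.Nullary using (¬_; Dec; yes; no; ¬?; _×-dec_)
open import Relation.Nullary.Decidable using (⌊_⌋; True; isYes; toWitness; decidable-stable)
open import Relation.Unary using (Pred; Decidable)
open import Relation.Unary.Properties using (∁?)
open import Relation.Binary.PropositionalEquality using (_≡_; _≢_; refl; sym; trans; cong; cong₂; subst; subst₂;
  module ≡-Reasoning)

private
  variable
    A B : Set

Unique-⊆⇒length≤ : {A : Set} {xs ys : List A} → Unique xs → xs ⊆ ys → length xs ≤ length ys
Unique-⊆⇒length≤ {xs = []} _ _ = z≤n
Unique-⊆⇒length≤ {xs = x ∷ xs} {ys} (x∉xs ∷ u) xs⊆ys with ∈-∃++ (xs⊆ys (here refl))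
... | ys₁ , ys₂ , refl = suc-length≤
  where
  remove : ∀ {y} (zs : List _) {ws} → y ∈ zs ++ x ∷ ws → y ≢ x → y ∈ zs ++ ws
  remove [] (here y≡x) y≢x = ⊥-elim (y≢x y≡x)
  remove [] (there y∈) _ = y∈
  remove (z ∷ zs) (here y≡z) _ = here y≡z
  remove (z ∷ zs) (there y∈) y≢x = there (remove zs y∈ y≢x)
  xs⊆rest : xs ⊆ ys₁ ++ ys₂
  xs⊆rest y∈xs = remove ys₁ (xs⊆ys (there y∈xs)) (λ y≡x → All.lookup x∉xs y∈xs (sym y≡x))
  suc-length≤ : suc (length xs) ≤ length (ys₁ ++ x ∷ ys₂)
  suc-length≤ rewrite length-++ ys₁ {x ∷ ys₂} | +-suc (length ys₁) (length ys₂) =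
    s≤s (subst (length xs ≤_) (length-++ ys₁) (Unique-⊆⇒length≤ u xs⊆rest))

Unique-All≡⇒length≤1 : ∀ (e : A) {xs} → Unique xs → All (_≡ e) xs → length xs ≤ 1
Unique-All≡⇒length≤1 e u all≡e = Unique-⊆⇒length≤ {ys = [ e ]} u (λ x∈ → here (All.lookup all≡e x∈))

∈-concatMap⁻′ : ∀ (f : A → List B) xs {z} → z ∈ concatMap f xs → ∃ λ x → x ∈ xs × z ∈ f x
∈-concatMap⁻′ f xs z∈ = find (∈-concatMap⁻ f {xs = xs} z∈)

∈-concatMap⁺′ : ∀ (f : A → List B) {xs x z} → x ∈ xs → z ∈ f x → z ∈ concatMap f xs
∈-concatMap⁺′ f {xs} x∈ z∈ = ∈-concatMap⁺ f {xs = xs} (lose x∈ z∈)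

Unique-concatMap⁺ : ∀ {A B : Set} (f : A → List B) {xs} → Unique xs → (∀ x → Unique (f x)) →
  (∀ {x y z} → x ∈ xs → y ∈ xs → z ∈ f x → z ∈ f y → x ≡ y) → Unique (concatMap f xs)
Unique-concatMap⁺ f {[]} _ _ _ = []
Unique-concatMap⁺ f {x ∷ xs} (x∉xs ∷ u) uf disjoint = prepend (f x) (uf x) (λ z∈ → z∈)
  where
  rest : Unique (concatMap f xs)
  rest = Unique-concatMap⁺ f u uf (λ x∈ y∈ → disjoint (there x∈) (there y∈))
  fresh : ∀ {z} → z ∈ f x → z ∉ concatMap f xs
  fresh z∈fx z∈rest with ∈-concatMap⁻′ f xs z∈rest
  ... | y , y∈xs , z∈fy = All.lookup x∉xs y∈xs (disjoint (here refl) (there y∈xs) z∈fx z∈fy)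
  prepend : (ys : List _) → Unique ys → ys ⊆ f x → Unique (ys ++ concatMap f xs)
  prepend [] _ _ = rest
  prepend (y ∷ ys) (y∉ys ∷ uys) ys⊆ = All.tabulate y≢ ∷ prepend ys uys (λ w∈ → ys⊆ (there w∈))
    where
    y≢ : ∀ {w} → w ∈ ys ++ concatMap f xs → y ≢ w
    y≢ w∈ refl with ∈-++⁻ ys w∈
    ... | inj₁ y∈ys = All.lookup y∉ys y∈ys refl
    ... | inj₂ y∈rest = fresh (ys⊆ (here refl)) y∈rest

Unique-map⁺-on : ∀ {A B : Set} (f : A → B) {xs} → Unique xs →
  (∀ {x y} → x ∈ xs → y ∈ xs → f x ≡ f y → x ≡ y) → Unique (map f xs)
Unique-map⁺-on f {[]} _ _ = []
Unique-map⁺-on f {x ∷ xs} (x∉xs ∷ u) inj =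
  All.tabulate fx≢ ∷ Unique-map⁺-on f u (λ x∈ y∈ → inj (there x∈) (there y∈))
  where
  fx≢ : ∀ {w} → w ∈ map f xs → f x ≢ w
  fx≢ w∈ fx≡w with ∈-map⁻ f w∈
  ... | y , y∈xs , refl = All.lookup x∉xs y∈xs (inj (here refl) (there y∈xs) fx≡w)

length-concatMap : ∀ (f : A → List B) (g : A → ℕ) → (∀ x → length (f x) ≡ g x) →
  ∀ xs → length (concatMap f xs) ≡ sum (map g xs)
length-concatMap f g eq [] = refl
length-concatMap f g eq (x ∷ xs)
  rewrite length-++ (f x) {concatMap f xs} | eq x | length-concatMap f g eq xs = refl

length-concatMap-const : ∀ (f : A → List B) b → (∀ x → length (f x) ≡ b) →
  ∀ xs → length (concatMap f xs) ≡ length xs * b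
length-concatMap-const f b eq [] = refl
length-concatMap-const f b eq (x ∷ xs)
  rewrite length-++ (f x) {concatMap f xs} | eq x | length-concatMap-const f b eq xs = refl

*-length-concatMap-≤ : ∀ (f : A → List B) k b xs → (∀ {x} → x ∈ xs → k * length (f x) ≤ b) →
  k * length (concatMap f xs) ≤ length xs * b
*-length-concatMap-≤ f k b [] _ rewrite *-zeroʳ k = z≤n
*-length-concatMap-≤ f k b (x ∷ xs) bound
  rewrite length-++ (f x) {concatMap f xs} | *-distribˡ-+ k (length (f x)) (length (concatMap f xs)) =
  +-mono-≤ (bound (here refl)) (*-length-concatMap-≤ f k b xs (λ x∈ → bound (there x∈)))

length-concatMap-≤ : ∀ (f : A → List B) b xs → (∀ {x} → x ∈ xs → length (f x) ≤ b) →
  length (concatMap f xs) ≤ length xs * b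
length-concatMap-≤ f b xs bound =
  subst (_≤ length xs * b) (*-identityˡ _)
    (*-length-concatMap-≤ f 1 b xs (λ {x} x∈ → subst (_≤ b) (sym (*-identityˡ _)) (bound x∈)))

module _ {P : Pred A 0ℓ} (P? : Decidable P) where

  length-filter+length-filter∁ : ∀ xs → length xs ≡ length (filter P? xs) + length (filter (∁? P?) xs)
  length-filter+length-filter∁ [] = refl
  length-filter+length-filter∁ (x ∷ xs) with P? x
  ... | yes _ = cong suc (length-filter+length-filter∁ xs)
  ... | no _ = trans (cong suc (length-filter+length-filter∁ xs)) (sym (+-suc _ _))

length-filter-cong : ∀ {P Q : Pred A 0ℓ} (P? : Decidable P) (Q? : Decidable Q) →
  (∀ x → P x → Q x) → (∀ x → Q x → P x) → ∀ xs → length (filter P? xs) ≡ length (filter Q? xs)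
length-filter-cong P? Q? P⇒Q Q⇒P [] = refl
length-filter-cong P? Q? P⇒Q Q⇒P (x ∷ xs) with P? x | Q? x
... | yes _ | yes _ = cong suc (length-filter-cong P? Q? P⇒Q Q⇒P xs)
... | yes p | no ¬q = ⊥-elim (¬q (P⇒Q x p))
... | no ¬p | yes q = ⊥-elim (¬p (Q⇒P x q))
... | no _ | no _ = length-filter-cong P? Q? P⇒Q Q⇒P xs

take-length-++ : ∀ (xs ys : List A) → take (length xs) (xs ++ ys) ≡ xs
take-length-++ [] ys = refl
take-length-++ (x ∷ xs) ys = cong (x ∷_) (take-length-++ xs ys)

drop-length-++ : ∀ (xs ys : List A) → drop (length xs) (xs ++ ys) ≡ ys
drop-length-++ [] ys = refl
drop-length-++ (x ∷ xs) ys = drop-length-++ xs ys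

Unique-++⁻ˡ : ∀ (xs : List A) {ys} → Unique (xs ++ ys) → Unique xs
Unique-++⁻ˡ [] _ = []
Unique-++⁻ˡ (x ∷ xs) (x∉ ∷ u) = AllP.++⁻ˡ xs x∉ ∷ Unique-++⁻ˡ xs u

Unique-++⁻ʳ : ∀ (xs : List A) {ys} → Unique (xs ++ ys) → Unique ys
Unique-++⁻ʳ [] u = u
Unique-++⁻ʳ (x ∷ xs) (_ ∷ u) = Unique-++⁻ʳ xs u

Unique-++⇒disjoint : ∀ (xs : List A) {ys v} → Unique (xs ++ ys) → v ∈ xs → v ∉ ys
Unique-++⇒disjoint (x ∷ xs) (x∉ ∷ u) (here refl) v∈ys = All.lookup x∉ (∈-++⁺ʳ xs v∈ys) refl
Unique-++⇒disjoint (x ∷ xs) (_ ∷ u) (there v∈xs) = Unique-++⇒disjoint xs u v∈xs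

Unique-reverse⁺ : {xs : List A} → Unique xs → Unique (reverse xs)
Unique-reverse⁺ {xs = []} _ = []
Unique-reverse⁺ {xs = x ∷ xs} (x∉ ∷ u) rewrite unfold-reverse x xs =
  UniqueP.++⁺ (Unique-reverse⁺ u) ([] ∷ []) λ { (x∈ , here refl) → All.lookup x∉ (AnyP.reverse⁻ x∈) refl }

map-++⁻ : ∀ (f : A → B) xs (as bs : List B) → map f xs ≡ as ++ bs →
  ∃ λ xs₁ → ∃ λ xs₂ → xs ≡ xs₁ ++ xs₂ × map f xs₁ ≡ as × map f xs₂ ≡ bs
map-++⁻ f xs [] bs eq = [] , xs , refl , refl , eq
map-++⁻ f (x ∷ xs) (a ∷ as) bs eq with map-++⁻ f xs as bs (∷-injectiveʳ eq)
... | xs₁ , xs₂ , refl , refl , eq₂ = x ∷ xs₁ , xs₂ , refl , cong (_∷ _) (∷-injectiveˡ eq) , eq₂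

map²-≡⇒partner : ∀ (f g : A → B) (xs ys : List A) {i} → map f xs ≡ map f ys → map g xs ≡ map g ys →
  i ∈ xs → ∃ λ j → j ∈ ys × f i ≡ f j × g i ≡ g j
map²-≡⇒partner f g (x ∷ xs) (y ∷ ys) eqf eqg (here refl) = y , here refl , ∷-injectiveˡ eqf , ∷-injectiveˡ eqg
map²-≡⇒partner f g (x ∷ xs) (y ∷ ys) eqf eqg (there i∈) with
  map²-≡⇒partner f g xs ys (∷-injectiveʳ eqf) (∷-injectiveʳ eqg) i∈
... | j , j∈ , fi≡fj , gi≡gj = j , there j∈ , fi≡fj , gi≡gj

squareWalkBound : ℕ → ℕ → ℕ
squareWalkBound Δ k = 2 * (suc k * Δ ^ (k + suc k))

module Walks (G : Graph) where

  open Graph G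

  data Walk : Fin n → List (Fin m) → Fin n → Set where
    [] : ∀ u → Walk u [] u
    _∷_ : ∀ {u v w es} {e} → Joins G e u v → Walk v es w → Walk u (e ∷ es) w

  Joins-sym : ∀ {e u v} → Joins G e u v → Joins G e v u
  Joins-sym (inj₁ p) = inj₂ p
  Joins-sym (inj₂ p) = inj₁ p

  Walk-++ : ∀ {u v w as bs} → Walk u as v → Walk v bs w → Walk u (as ++ bs) w
  Walk-++ ([] _) q = q
  Walk-++ (j ∷ p) q = j ∷ Walk-++ p q

  Walk-++⁻ : ∀ as {bs u w} → Walk u (as ++ bs) w → ∃ λ v → Walk u as v × Walk v bs w
  Walk-++⁻ [] {u = u} p = u , [] u , p
  Walk-++⁻ (a ∷ as) (j ∷ p) with Walk-++⁻ as p
  ... | v , p₁ , p₂ = v , j ∷ p₁ , p₂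

  Walk-reverse : ∀ {u es w} → Walk u es w → Walk w (reverse es) u
  Walk-reverse ([] u) = [] u
  Walk-reverse {u} (_∷_ {es = es} {e} j p) rewrite unfold-reverse e es =
    Walk-++ (Walk-reverse p) (Joins-sym j ∷ [] u)

  IsWalk⇒Walk : ∀ {v vs es} → IsWalk G (v ∷ vs) es → ∃ λ w → Walk v es w
  IsWalk⇒Walk (single v) = v , [] v
  IsWalk⇒Walk (step e j w) with IsWalk⇒Walk w
  ... | y , p = y , j ∷ p

  incidences : Fin n → Fin m → Fin n × Fin n → List (Fin m × Fin n)
  incidences u e (a , b) with a ≟ u | b ≟ u
  ... | yes _ | _ = [ (e , b) ]
  ... | no _ | yes _ = [ (e , a) ]
  ... | no _ | no _ = []

  neighbours : Fin n → List (Fin m × Fin n)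
  neighbours u = concatMap (λ e → incidences u e (ends e)) (allFin m)

  length-incidences : ∀ u e p → length (incidences u e p) ≡ (if ⌊ proj₁ p ≟ u ⌋ ∨ ⌊ proj₂ p ≟ u ⌋ then 1 else 0)
  length-incidences u e (a , b) with a ≟ u | b ≟ u
  ... | yes _ | _ = refl
  ... | no _ | yes _ = refl
  ... | no _ | no _ = refl

  length-neighbours : ∀ u → length (neighbours u) ≡ degree G u
  length-neighbours u = length-concatMap _ (incident G u) (λ e → length-incidences u e (ends e)) (allFin m)

  ∈-incidences⁺ : ∀ {u v} e p → (p ≡ (u , v) ⊎ p ≡ (v , u)) → (e , v) ∈ incidences u e p
  ∈-incidences⁺ {u} {v} e .(u , v) (inj₁ refl) with u ≟ u
  ... | yes _ = here refl
  ... | no u≢u = ⊥-elim (u≢u refl)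
  ∈-incidences⁺ {u} {v} e .(v , u) (inj₂ refl) with v ≟ u | u ≟ u
  ... | yes refl | _ = here refl
  ... | no _ | yes _ = here refl
  ... | no _ | no u≢u = ⊥-elim (u≢u refl)

  ∈-incidences⁻ : ∀ {u v e′} e p → (e′ , v) ∈ incidences u e p → e′ ≡ e × (p ≡ (u , v) ⊎ p ≡ (v , u))
  ∈-incidences⁻ {u} e (a , b) e∈ with a ≟ u | b ≟ u
  ∈-incidences⁻ e (a , b) (here refl) | yes refl | _ = refl , inj₁ refl
  ∈-incidences⁻ e (a , b) (here refl) | no _ | yes refl = refl , inj₂ refl

  ∈-neighbours⁺ : ∀ {e u v} → Joins G e u v → (e , v) ∈ neighbours u
  ∈-neighbours⁺ {e} j = ∈-concatMap⁺′ _ (∈-allFin e) (∈-incidences⁺ e (ends e) j)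

  ∈-neighbours⁻ : ∀ {e u v} → (e , v) ∈ neighbours u → Joins G e u v
  ∈-neighbours⁻ {u = u} ev∈ with ∈-concatMap⁻′ (λ e → incidences u e (ends e)) (allFin m) ev∈
  ... | e , _ , ev∈′ with ∈-incidences⁻ e (ends e) ev∈′
  ... | refl , j = j

  walksFrom : Fin n → ℕ → List (List (Fin m))
  walksFrom u zero = [ [] ]
  walksFrom u (suc k) = concatMap (λ (e , v) → map (e ∷_) (walksFrom v k)) (neighbours u)

  length-walksFrom : ∀ {Δ} → (∀ v → degree G v ≤ Δ) → ∀ u k → length (walksFrom u k) ≤ Δ ^ k
  length-walksFrom degΔ u zero = ≤-refl
  length-walksFrom {Δ} degΔ u (suc k) = begin
    length (walksFrom u (suc k)) ≤⟨ length-concatMap-≤ _ (Δ ^ k) (neighbours u)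
                                      (λ {(e , v)} _ → subst (_≤ Δ ^ k) (sym (length-map (e ∷_) (walksFrom v k)))
                                                         (length-walksFrom degΔ v k)) ⟩
    length (neighbours u) * Δ ^ k ≤⟨ *-monoˡ-≤ (Δ ^ k) (subst (_≤ Δ) (sym (length-neighbours u)) (degΔ u)) ⟩
    Δ ^ suc k ∎
    where open ≤-Reasoning

  ∈-walksFrom⁺ : ∀ {u es w} → Walk u es w → es ∈ walksFrom u (length es)
  ∈-walksFrom⁺ ([] u) = here refl
  ∈-walksFrom⁺ (_∷_ {es = es} {e} j p) = ∈-concatMap⁺′ _ (∈-neighbours⁺ j) (∈-map⁺ (e ∷_) (∈-walksFrom⁺ p))

  ∈-walksFrom⁻ : ∀ {u} k {es} → es ∈ walksFrom u k → (∃ λ w → Walk u es w) × length es ≡ k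
  ∈-walksFrom⁻ {u} zero (here refl) = (u , [] u) , refl
  ∈-walksFrom⁻ {u} (suc k) es∈ with ∈-concatMap⁻′ (λ (e , v) → map (e ∷_) (walksFrom v k)) (neighbours u) es∈
  ... | (e , v) , ev∈ , es∈′ with ∈-map⁻ (e ∷_) es∈′
  ... | es′ , es′∈ , refl with ∈-walksFrom⁻ k es′∈
  ... | (w , p) , len = (w , ∈-neighbours⁻ ev∈ ∷ p) , cong suc len

  orientations : Fin m → List (Fin n × Fin n)
  orientations e = ends e ∷ swap (ends e) ∷ []

  ∈-orientations⁻ : ∀ {e ab} → ab ∈ orientations e → Joins G e (proj₁ ab) (proj₂ ab)
  ∈-orientations⁻ (here refl) = inj₁ refl
  ∈-orientations⁻ (there (here refl)) = inj₂ refl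

  ∈-orientations⁺ : ∀ {e a b} → Joins G e a b → (a , b) ∈ orientations e
  ∈-orientations⁺ (inj₁ p) = here (sym p)
  ∈-orientations⁺ (inj₂ p) = there (here (cong swap (sym p)))

  SquareWalk : Fin m → ℕ → List (Fin m) × List (Fin m) → Set
  SquareWalk e k (A , B) = (∃₂ λ x y → Walk x (A ++ B) y) × length A ≡ suc k × length B ≡ suc k × e ∈ A

  splitAround : Fin m → ℕ → List (Fin m) → List (Fin m) → List (Fin m) × List (Fin m)
  splitAround e j back fwd = (reverse back ++ e ∷ take j fwd , drop j fwd)

  -- e is traversed from a to b and is preceded by i edges of the first half
  squareWalksAt : Fin m → ℕ → Fin n × Fin n → ℕ → List (List (Fin m) × List (Fin m))
  squareWalksAt e k (a , b) i =
    concatMap (λ back → map (splitAround e (k ∸ i) back) (walksFrom b (k ∸ i + suc k))) (walksFrom a i)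

  squareWalksThrough : Fin m → ℕ → List (List (Fin m) × List (Fin m))
  squareWalksThrough e k = concatMap (λ ab → concatMap (squareWalksAt e k ab) (upTo (suc k))) (orientations e)

  ∈-squareWalksThrough⁻ : ∀ e k {AB} → AB ∈ squareWalksThrough e k → SquareWalk e k AB
  ∈-squareWalksThrough⁻ e k AB∈
    with ∈-concatMap⁻′ (λ ab → concatMap (squareWalksAt e k ab) (upTo (suc k))) (orientations e) AB∈
  ... | (a , b) , ab∈ , AB∈₁ with ∈-concatMap⁻′ (squareWalksAt e k (a , b)) (upTo (suc k)) AB∈₁
  ... | i , i∈ , AB∈₂
    with ∈-concatMap⁻′ (λ back → map (splitAround e (k ∸ i) back) (walksFrom b (k ∸ i + suc k))) (walksFrom a i) AB∈₂
  ... | back , back∈ , AB∈₃ with ∈-map⁻ (splitAround e (k ∸ i) back) AB∈₃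
  ... | fwd , fwd∈ , refl with ∈-walksFrom⁻ i back∈ | ∈-walksFrom⁻ (k ∸ i + suc k) fwd∈
  ... | (x , pb) , lb | (y , pf) , lf = (x , y , walk) , length-A , length-B , ∈-++⁺ʳ (reverse back) (here refl)
    where
    j = k ∸ i
    i≤k : i ≤ k
    i≤k = ≤-pred (∈-upTo⁻ i∈)
    walk : Walk x ((reverse back ++ e ∷ take j fwd) ++ drop j fwd) y
    walk = subst (λ es → Walk x es y)
      (sym (trans (++-assoc (reverse back) (e ∷ take j fwd) (drop j fwd))
                  (cong (λ t → reverse back ++ e ∷ t) (take++drop≡id j fwd))))
      (Walk-++ (Walk-reverse pb) (∈-orientations⁻ ab∈ ∷ pf))
    length-take-j : length (take j fwd) ≡ j
    length-take-j = trans (length-take j fwd) (m≤n⇒m⊓n≡m (subst (j ≤_) (sym lf) (m≤m+n j (suc k))))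
    length-A : length (reverse back ++ e ∷ take j fwd) ≡ suc k
    length-A = trans (length-++ (reverse back))
      (trans (cong₂ _+_ (trans (length-reverse back) lb) (cong suc length-take-j))
             (trans (+-suc i j) (cong suc (m+[n∸m]≡n i≤k))))
    length-B : length (drop j fwd) ≡ suc k
    length-B = trans (length-drop j fwd) (trans (cong (_∸ j) lf) (m+n∸m≡n j (suc k)))

  ∈-squareWalksThrough⁺ : ∀ e k A B {x y} → Walk x (A ++ B) y → length A ≡ suc k → length B ≡ suc k →
    e ∈ A → (A , B) ∈ squareWalksThrough e k
  ∈-squareWalksThrough⁺ e k A B walk lA lB e∈A with ∈-∃++ e∈A
  ... | A₁ , A₂ , refl with Walk-++⁻ A₁ (subst (λ es → Walk _ es _) (++-assoc A₁ (e ∷ A₂) B) walk)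
  ... | a , p₁ , _∷_ {v = b} j pf =
    ∈-concatMap⁺′ (λ ab → concatMap (squareWalksAt e k ab) (upTo (suc k))) (∈-orientations⁺ j)
      (∈-concatMap⁺′ (squareWalksAt e k (a , b)) (∈-upTo⁺ (s≤s i≤k))
        (∈-concatMap⁺′ (λ back → map (splitAround e (k ∸ i) back) (walksFrom b (k ∸ i + suc k))) back∈
          (subst (_∈ map (splitAround e (k ∸ i) (reverse A₁)) (walksFrom b (k ∸ i + suc k))) split≡
            (∈-map⁺ (splitAround e (k ∸ i) (reverse A₁)) fwd∈))))
    where
    i = length A₁
    k≡i+j : k ≡ i + length A₂
    k≡i+j = suc-injective (trans (sym (trans (sym (length-++ A₁)) lA)) (+-suc i (length A₂)))
    j≡ : length A₂ ≡ k ∸ i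
    j≡ = sym (trans (cong (_∸ i) k≡i+j) (m+n∸m≡n i (length A₂)))
    i≤k : i ≤ k
    i≤k = subst (i ≤_) (sym k≡i+j) (m≤m+n i (length A₂))
    back∈ : reverse A₁ ∈ walksFrom a i
    back∈ = subst (λ l → reverse A₁ ∈ walksFrom a l) (length-reverse A₁) (∈-walksFrom⁺ (Walk-reverse p₁))
    fwd∈ : A₂ ++ B ∈ walksFrom b (k ∸ i + suc k)
    fwd∈ = subst (λ l → A₂ ++ B ∈ walksFrom b l) (trans (length-++ A₂) (cong₂ _+_ j≡ lB)) (∈-walksFrom⁺ pf)
    split≡ : splitAround e (k ∸ i) (reverse A₁) (A₂ ++ B) ≡ (A₁ ++ e ∷ A₂ , B)
    split≡ rewrite sym j≡ | reverse-involutive A₁ | take-length-++ A₂ B | drop-length-++ A₂ B = refl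

  module _ {Δ} (degΔ : ∀ v → degree G v ≤ Δ) where

    length-squareWalksAt : ∀ e k ab i → i ≤ k → length (squareWalksAt e k ab i) ≤ Δ ^ (k + suc k)
    length-squareWalksAt e k (a , b) i i≤k = begin
      length (squareWalksAt e k (a , b) i)
        ≤⟨ length-concatMap-≤ _ (Δ ^ j) (walksFrom a i)
             (λ {back} _ → subst (_≤ Δ ^ j) (sym (length-map _ (walksFrom b j))) (length-walksFrom degΔ b j)) ⟩
      length (walksFrom a i) * Δ ^ j ≤⟨ *-monoˡ-≤ (Δ ^ j) (length-walksFrom degΔ a i) ⟩
      Δ ^ i * Δ ^ j                  ≡⟨ sym (^-distribˡ-+-* Δ i j) ⟩
      Δ ^ (i + j)                    ≡⟨ cong (Δ ^_) (trans (sym (+-assoc i (k ∸ i) (suc k))) (cong (_+ suc k) (m+[n∸m]≡n i≤k))) ⟩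
      Δ ^ (k + suc k)                ∎
      where
      open ≤-Reasoning
      j = k ∸ i + suc k

    length-squareWalksThrough : ∀ e k → length (squareWalksThrough e k) ≤ squareWalkBound Δ k
    length-squareWalksThrough e k =
      length-concatMap-≤ (λ ab → concatMap (squareWalksAt e k ab) (upTo (suc k))) _ (orientations e) λ {ab} _ →
        subst (length (concatMap (squareWalksAt e k ab) (upTo (suc k))) ≤_)
          (cong (_* Δ ^ (k + suc k)) (length-upTo (suc k)))
          (length-concatMap-≤ (squareWalksAt e k ab) _ (upTo (suc k))
            (λ i∈ → length-squareWalksAt e k ab _ (≤-pred (∈-upTo⁻ i∈))))

  Joins⇒endpoint : ∀ {e u v} → Joins G e u v → u ≡ proj₁ (ends e) ⊎ u ≡ proj₂ (ends e)
  Joins⇒endpoint (inj₁ p) = inj₁ (sym (cong proj₁ p))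
  Joins⇒endpoint (inj₂ p) = inj₂ (sym (cong proj₂ p))

  IsWalk-endpoints∈ : ∀ {vs es e} → IsWalk G vs es → e ∈ es → proj₁ (ends e) ∈ vs × proj₂ (ends e) ∈ vs
  IsWalk-endpoints∈ (step e (inj₁ p) w) (here refl) rewrite p = here refl , there (here refl)
  IsWalk-endpoints∈ (step e (inj₂ p) w) (here refl) rewrite p = there (here refl) , here refl
  IsWalk-endpoints∈ (step e j w) (there e∈) with IsWalk-endpoints∈ w e∈
  ... | a∈ , b∈ = there a∈ , there b∈

  IsPath⇒Unique-edges : ∀ {vs es} → IsPath G vs es → Unique es
  IsPath⇒Unique-edges (single v , _) = []
  IsPath⇒Unique-edges {u ∷ v ∷ vs} (step {es = es} e j w , u∉ ∷ uvs) =
    All.tabulate (λ { e∈ refl → e∉es e∈ }) ∷ IsPath⇒Unique-edges (w , uvs)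
    where
    e∉es : e ∉ es
    e∉es e∈ with IsWalk-endpoints∈ w e∈ | Joins⇒endpoint j
    ... | a∈ , _ | inj₁ eq = All.lookup u∉ (subst (_∈ v ∷ vs) (sym eq) a∈) refl
    ... | _ , b∈ | inj₂ eq = All.lookup u∉ (subst (_∈ v ∷ vs) (sym eq) b∈) refl

  Unique⇒length≤m : ∀ {es : List (Fin m)} → Unique es → length es ≤ m
  Unique⇒length≤m {es} u = subst (length es ≤_) (length-tabulate {n = m} (λ i → i)) (Unique-⊆⇒length≤ u (λ {x} _ → ∈-allFin x))

-- A colouring of an edge set F is a vector over all edges carrying the dummy
-- colour 0 outside F; this makes the colourings of F from the lists a finite list.
FromLists : ∀ {k} → (Fin k → Bool) → (Fin k → List ℕ) → Vec ℕ k → Set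
FromLists F L φ = ∀ i → (F i ≡ true → lookup φ i ∈ L i) × (F i ≡ false → lookup φ i ≡ 0)

choices : Bool → List ℕ → List ℕ
choices true xs = xs
choices false _ = [ 0 ]

colourings : ∀ {k} → (Fin k → Bool) → (Fin k → List ℕ) → List (Vec ℕ k)
colourings {zero} F L = [ [] ]
colourings {suc k} F L =
  concatMap (λ x → map (x ∷_) (colourings (λ i → F (suc i)) (λ i → L (suc i)))) (choices (F zero) (L zero))

∈-colourings⁻ : ∀ {k} (F : Fin k → Bool) L {φ} → φ ∈ colourings F L → FromLists F L φ
∈-colourings⁻ {zero} F L _ ()
∈-colourings⁻ {suc k} F L φ∈
  with ∈-concatMap⁻′ (λ x → map (x ∷_) (colourings (λ i → F (suc i)) (λ i → L (suc i)))) (choices (F zero) (L zero)) φ∈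
... | x , x∈ , φ∈′ with ∈-map⁻ (x ∷_) φ∈′
... | ψ , ψ∈ , refl = ok
  where
  choice⁻ : ∀ b {xs x} → x ∈ choices b xs → (b ≡ true → x ∈ xs) × (b ≡ false → x ≡ 0)
  choice⁻ true x∈ = (λ _ → x∈) , (λ ())
  choice⁻ false (here refl) = (λ ()) , (λ _ → refl)
  ok : FromLists F L (x ∷ ψ)
  ok zero = choice⁻ (F zero) x∈
  ok (suc i) = ∈-colourings⁻ (λ i → F (suc i)) (λ i → L (suc i)) ψ∈ i

∈-colourings⁺ : ∀ {k} (F : Fin k → Bool) L {φ} → FromLists F L φ → φ ∈ colourings F L
∈-colourings⁺ {zero} F L {[]} _ = here refl
∈-colourings⁺ {suc k} F L {x ∷ ψ} φ-ok =
  ∈-concatMap⁺′ (λ x → map (x ∷_) (colourings (λ i → F (suc i)) (λ i → L (suc i))))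
    (choice⁺ (F zero) (φ-ok zero))
    (∈-map⁺ (x ∷_) (∈-colourings⁺ (λ i → F (suc i)) (λ i → L (suc i)) (λ i → φ-ok (suc i))))
  where
  choice⁺ : ∀ b {xs x} → (b ≡ true → x ∈ xs) × (b ≡ false → x ≡ 0) → x ∈ choices b xs
  choice⁺ true (x∈ , _) = x∈ refl
  choice⁺ false (_ , x≡0) rewrite x≡0 refl = here refl

Unique-colourings : ∀ {k} (F : Fin k → Bool) L → (∀ i → Unique (L i)) → Unique (colourings F L)
Unique-colourings {zero} F L _ = [] ∷ []
Unique-colourings {suc k} F L u =
  Unique-concatMap⁺ _ (Unique-choices (F zero) (u zero))
    (λ x → UniqueP.map⁺ ∷-injectiveʳ-Vec (Unique-colourings _ _ (λ i → u (suc i))))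
    (λ _ _ → head≡)
  where
  Unique-choices : ∀ b {xs} → Unique xs → Unique (choices b xs)
  Unique-choices true u = u
  Unique-choices false _ = [] ∷ []
  head≡ : ∀ {x y z} {vs : List (Vec ℕ k)} → z ∈ map (x ∷_) vs → z ∈ map (y ∷_) vs → x ≡ y
  head≡ z∈x z∈y with ∈-map⁻ _ z∈x | ∈-map⁻ _ z∈y
  ... | _ , _ , refl | _ , _ , refl = refl

colourings-cong : ∀ {k} (F F′ : Fin k → Bool) L → (∀ i → F i ≡ F′ i) → colourings F L ≡ colourings F′ L
colourings-cong {zero} F F′ L eq = refl
colourings-cong {suc k} F F′ L eq
  rewrite eq zero | colourings-cong (λ i → F (suc i)) (λ i → F′ (suc i)) (λ i → L (suc i)) (λ i → eq (suc i)) = refl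

-- c^(K-1) · Σ_{k<K} squareWalkBound Δ k / c^k, in integers.
scaledSeries : ℕ → ℕ → ℕ → ℕ
scaledSeries Δ c zero = 0
scaledSeries Δ c (suc K) = c * scaledSeries Δ c K + squareWalkBound Δ K

excess-bound : ∀ {A G b l c} → c ≤ l → A * l ≤ G + b → b ≤ (l ∸ c) * A → c * A ≤ G
excess-bound {A} {G} {b} {l} {c} c≤l total bad≤ = +-cancelˡ-≤ ((l ∸ c) * A) (c * A) G (begin
  (l ∸ c) * A + c * A ≡⟨ sym (*-distribʳ-+ A (l ∸ c) c) ⟩
  (l ∸ c + c) * A     ≡⟨ cong (_* A) (m∸n+n≡m c≤l) ⟩
  l * A               ≡⟨ *-comm l A ⟩
  A * l               ≤⟨ total ⟩
  G + b               ≤⟨ +-monoʳ-≤ G bad≤ ⟩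
  G + (l ∸ c) * A     ≡⟨ +-comm G ((l ∸ c) * A) ⟩
  (l ∸ c) * A + G     ∎)
  where open ≤-Reasoning

module Counting (G : Graph) (L : Fin (Graph.m G) → List ℕ) (L-unique : ∀ e → Unique (L e)) where

  open Graph G
  open Walks G
  open import Data.List.Membership.DecPropositional (_≟_ {m}) using (_∈?_)
  open import Data.List.Relation.Unary.Unique.DecPropositional (_≟_ {m}) using (unique?)

  Colouring : Set
  Colouring = Vec ℕ m

  EdgeSet : Set
  EdgeSet = Fin m → Bool

  candidateSquares : List (List (Fin m) × List (Fin m))
  candidateSquares = concatMap (λ e → concatMap (squareWalksThrough e) (upTo m)) (allFin m)

  ∈-candidateSquares⁺ : ∀ {e k AB} → k < m → AB ∈ squareWalksThrough e k → AB ∈ candidateSquares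
  ∈-candidateSquares⁺ {e} k<m AB∈ =
    ∈-concatMap⁺′ (λ e → concatMap (squareWalksThrough e) (upTo m)) (∈-allFin e)
      (∈-concatMap⁺′ (squareWalksThrough e) (∈-upTo⁺ k<m) AB∈)

  ∈-candidateSquares⁻ : ∀ {AB} → AB ∈ candidateSquares → ∃₂ λ e k → k < m × AB ∈ squareWalksThrough e k
  ∈-candidateSquares⁻ AB∈ with ∈-concatMap⁻′ (λ e → concatMap (squareWalksThrough e) (upTo m)) (allFin m) AB∈
  ... | e , _ , AB∈′ with ∈-concatMap⁻′ (squareWalksThrough e) (upTo m) AB∈′
  ... | k , k∈ , AB∈″ = e , k , ∈-upTo⁻ k∈ , AB∈″

  _⊆ₑ_ : List (Fin m) → EdgeSet → Set
  es ⊆ₑ F = All (λ i → F i ≡ true) es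

  SquareIn : EdgeSet → Colouring → List (Fin m) × List (Fin m) → Set
  SquareIn F φ (A , B) = Unique (A ++ B) × (A ++ B) ⊆ₑ F × map (lookup φ) A ≡ map (lookup φ) B

  SquareIn? : ∀ F φ AB → Dec (SquareIn F φ AB)
  SquareIn? F φ (A , B) =
    unique? (A ++ B) ×-dec All.all? (λ i → F i Bool.≟ true) (A ++ B) ×-dec ≡-dec ℕ._≟_ (map (lookup φ) A) (map (lookup φ) B)

  SquareFree : EdgeSet → Colouring → Set
  SquareFree F φ = All (λ AB → ¬ SquareIn F φ AB) candidateSquares

  SquareFree? : ∀ F φ → Dec (SquareFree F φ)
  SquareFree? F φ = All.all? (λ AB → ¬? (SquareIn? F φ AB)) candidateSquares

  ¬SquareFree⇒SquareIn : ∀ F φ → ¬ SquareFree F φ → ∃ λ AB → AB ∈ candidateSquares × SquareIn F φ AB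
  ¬SquareFree⇒SquareIn F φ ¬free with find (¬All⇒Any¬ (λ AB → ¬? (SquareIn? F φ AB)) candidateSquares ¬free)
  ... | AB , AB∈ , ¬¬sq = AB , AB∈ , decidable-stable (SquareIn? F φ AB) ¬¬sq

  goodColourings : EdgeSet → List Colouring
  goodColourings F = filter (SquareFree? F) (colourings F L)

  count : EdgeSet → ℕ
  count F = length (goodColourings F)

  ∈-goodColourings⁻ : ∀ {F ψ} → ψ ∈ goodColourings F → FromLists F L ψ × SquareFree F ψ
  ∈-goodColourings⁻ {F} ψ∈ with ∈-filter⁻ (SquareFree? F) {xs = colourings F L} ψ∈
  ... | ψ∈′ , free = ∈-colourings⁻ F L ψ∈′ , free

  ∈-goodColourings⁺ : ∀ {F ψ} → FromLists F L ψ → SquareFree F ψ → ψ ∈ goodColourings F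
  ∈-goodColourings⁺ {F} ok free = ∈-filter⁺ (SquareFree? F) (∈-colourings⁺ F L ok) free

  Unique-goodColourings : ∀ F → Unique (goodColourings F)
  Unique-goodColourings F = UniqueP.filter⁺ (SquareFree? F) (Unique-colourings F L L-unique)

  SquareIn-transfer : ∀ {F F′ φ ψ A B} → SquareIn F φ (A , B) → (A ++ B) ⊆ₑ F′ →
    All (λ i → lookup φ i ≡ lookup ψ i) (A ++ B) → SquareIn F′ ψ (A , B)
  SquareIn-transfer {A = A} (u , _ , sq) inF′ agree =
    u , inF′ , trans (sym (map-cong-local (AllP.++⁻ˡ A agree))) (trans sq (map-cong-local (AllP.++⁻ʳ A agree)))

  SquareFree-mono : ∀ F F′ ψ χ → SquareFree F ψ → (∀ i → F′ i ≡ true → F i ≡ true) →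
    (∀ i → F′ i ≡ true → lookup χ i ≡ lookup ψ i) → SquareFree F′ χ
  SquareFree-mono F F′ ψ χ free F′⊆F agree = All.tabulate λ {(A , B)} AB∈ sq@(_ , inF′ , _) →
    All.lookup free AB∈ (SquareIn-transfer {φ = χ} {ψ} {A} {B} sq (All.map (F′⊆F _) inF′) (All.map (agree _) inF′))

  count-cong : ∀ F F′ → (∀ i → F i ≡ F′ i) → count F ≡ count F′
  count-cong F F′ eq rewrite colourings-cong F F′ L eq =
    length-filter-cong (SquareFree? F) (SquareFree? F′)
      (λ φ free → SquareFree-mono F F′ φ φ free (λ i p → trans (eq i) p) (λ _ _ → refl))
      (λ φ free → SquareFree-mono F′ F φ φ free (λ i p → trans (sym (eq i)) p) (λ _ _ → refl))
      (colourings F′ L)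

  insert : EdgeSet → Fin m → EdgeSet
  insert F e i = ⌊ i ≟ e ⌋ ∨ F i

  insert-≢ : ∀ F {e i} → i ≢ e → insert F e i ≡ F i
  insert-≢ F {e} {i} i≢e with i ≟ e
  ... | yes i≡e = ⊥-elim (i≢e i≡e)
  ... | no _ = refl

  insert≡true⁻ : ∀ F e i → insert F e i ≡ true → i ≡ e ⊎ F i ≡ true
  insert≡true⁻ F e i p with i ≟ e
  ... | yes i≡e = inj₁ i≡e
  ... | no _ = inj₂ p

  size : EdgeSet → ℕ
  size F = length (filter (λ i → F i Bool.≟ true) (allFin m))

  size-< : ∀ F₁ F h → (∀ i → F₁ i ≡ true → F i ≡ true) → F h ≡ true → F₁ h ≡ false → size F₁ < size F
  size-< F₁ F h F₁⊆F Fh F₁h =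
    Unique-⊆⇒length≤ (All.tabulate h≢ ∷ UniqueP.filter⁺ _ (UniqueP.allFin⁺ m)) h∷F₁⊆F
    where
    h≢ : ∀ {x} → x ∈ filter (λ i → F₁ i Bool.≟ true) (allFin m) → h ≢ x
    h≢ x∈ refl with trans (sym F₁h) (proj₂ (∈-filter⁻ (λ i → F₁ i Bool.≟ true) {xs = allFin m} x∈))
    ... | ()
    h∷F₁⊆F : ∀ {x} → x ∈ h ∷ filter (λ i → F₁ i Bool.≟ true) (allFin m) → x ∈ filter (λ i → F i Bool.≟ true) (allFin m)
    h∷F₁⊆F (here refl) = ∈-filter⁺ (λ i → F i Bool.≟ true) (∈-allFin h) Fh
    h∷F₁⊆F (there x∈) with ∈-filter⁻ (λ i → F₁ i Bool.≟ true) {xs = allFin m} x∈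
    ... | x∈′ , p = ∈-filter⁺ (λ i → F i Bool.≟ true) x∈′ (F₁⊆F _ p)

  extensions : EdgeSet → Fin m → List Colouring
  extensions F e = concatMap (λ ψ → map (ψ [ e ]≔_) (L e)) (goodColourings F)

  length-extensions : ∀ F e → length (extensions F e) ≡ count F * length (L e)
  length-extensions F e =
    length-concatMap-const (λ ψ → map (ψ [ e ]≔_) (L e)) (length (L e)) (λ ψ → length-map (ψ [ e ]≔_) (L e)) (goodColourings F)

  ∈-extensions⁻ : ∀ {F e φ} → φ ∈ extensions F e → ∃₂ λ ψ x → ψ ∈ goodColourings F × x ∈ L e × φ ≡ ψ [ e ]≔ x
  ∈-extensions⁻ {F} {e} φ∈ with ∈-concatMap⁻′ (λ ψ → map (ψ [ e ]≔_) (L e)) (goodColourings F) φ∈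
  ... | ψ , ψ∈ , φ∈′ with ∈-map⁻ (ψ [ e ]≔_) φ∈′
  ... | x , x∈ , φ≡ = ψ , x , ψ∈ , x∈ , φ≡

  extension-FromLists : ∀ {F e φ} → F e ≡ false → φ ∈ extensions F e → FromLists (insert F e) L φ
  extension-FromLists {F} {e} Fe φ∈ i with ∈-extensions⁻ φ∈
  ... | ψ , x , ψ∈ , x∈ , refl with i ≟ e | proj₁ (∈-goodColourings⁻ ψ∈) i
  ... | yes refl | _ = (λ _ → subst (_∈ L i) (sym (lookup∘update i ψ x)) x∈) , (λ ())
  ... | no i≢e | ψ∈L , ψ≡0 =
    (λ p → subst (_∈ L i) (sym (lookup∘update′ i≢e ψ x)) (ψ∈L p)) , (λ p → trans (lookup∘update′ i≢e ψ x) (ψ≡0 p))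

  Unique-extensions : ∀ F e → F e ≡ false → Unique (extensions F e)
  Unique-extensions F e Fe = Unique-concatMap⁺ (λ ψ → map (ψ [ e ]≔_) (L e)) (Unique-goodColourings F)
    (λ ψ → UniqueP.map⁺ (λ {x} {y} eq → trans (sym (lookup∘update e ψ x)) (trans (cong (λ φ → lookup φ e) eq) (lookup∘update e ψ y)))
                        (L-unique e))
    same-base
    where
    same-base : ∀ {ψ ψ′ φ} → ψ ∈ goodColourings F → ψ′ ∈ goodColourings F →
      φ ∈ map (ψ [ e ]≔_) (L e) → φ ∈ map (ψ′ [ e ]≔_) (L e) → ψ ≡ ψ′
    same-base {ψ} {ψ′} ψ∈ ψ′∈ φ∈ φ∈′ with ∈-map⁻ (ψ [ e ]≔_) φ∈ | ∈-map⁻ (ψ′ [ e ]≔_) φ∈′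
    ... | x , _ , refl | y , _ , eq = Pointwise-≡⇒≡ (ext agree)
      where
      agree : ∀ i → lookup ψ i ≡ lookup ψ′ i
      agree i with i ≟ e
      ... | yes refl = trans (proj₂ (proj₁ (∈-goodColourings⁻ ψ∈) i) Fe) (sym (proj₂ (proj₁ (∈-goodColourings⁻ ψ′∈) i) Fe))
      ... | no i≢e = trans (sym (lookup∘update′ i≢e ψ x)) (trans (cong (λ φ → lookup φ i) eq) (lookup∘update′ i≢e ψ′ y))

  ∈?≡true : ∀ {i} {xs : List (Fin m)} → i ∈ xs → ⌊ i ∈? xs ⌋ ≡ true
  ∈?≡true {i} {xs} i∈ with i ∈? xs
  ... | yes _ = refl
  ... | no i∉ = ⊥-elim (i∉ i∈)

  ∈?≡false : ∀ {i} {xs : List (Fin m)} → i ∉ xs → ⌊ i ∈? xs ⌋ ≡ false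
  ∈?≡false {i} {xs} i∉ with i ∈? xs
  ... | yes i∈ = ⊥-elim (i∉ i∈)
  ... | no _ = refl

  ∈?≡true⁻ : ∀ {i} {xs : List (Fin m)} → ⌊ i ∈? xs ⌋ ≡ true → i ∈ xs
  ∈?≡true⁻ {i} {xs} p with i ∈? xs
  ... | yes i∈ = i∈

  ≡true-ext : ∀ {a b} → (a ≡ true → b ≡ true) → (b ≡ true → a ≡ true) → a ≡ b
  ≡true-ext {true} {true} _ _ = refl
  ≡true-ext {true} {false} a⇒b _ = sym (a⇒b refl)
  ≡true-ext {false} {true} _ b⇒a = b⇒a refl
  ≡true-ext {false} {false} _ _ = refl

  addAll : EdgeSet → List (Fin m) → EdgeSet
  addAll F hs i = F i ∨ ⌊ i ∈? hs ⌋

  addAll-⊇ : ∀ F hs {i} → F i ≡ true → addAll F hs i ≡ true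
  addAll-⊇ F hs p rewrite p = refl

  addAll-∈ : ∀ F {hs i} → i ∈ hs → addAll F hs i ≡ true
  addAll-∈ F {i = i} i∈ rewrite ∈?≡true i∈ = ∨-zeroʳ (F i)

  addAll≡true⁻ : ∀ F hs i → addAll F hs i ≡ true → F i ≡ true ⊎ i ∈ hs
  addAll≡true⁻ F hs i p with F i
  ... | true = inj₁ refl
  ... | false = inj₂ (∈?≡true⁻ p)

  removeAll : EdgeSet → List (Fin m) → EdgeSet
  removeAll F A i = F i ∧ not ⌊ i ∈? A ⌋

  removeAll-∈ : ∀ F {A i} → i ∈ A → removeAll F A i ≡ false
  removeAll-∈ F {i = i} i∈ rewrite ∈?≡true i∈ = ∧-zeroʳ (F i)

  removeAll≡true⁺ : ∀ F {A i} → i ∉ A → F i ≡ true → removeAll F A i ≡ true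
  removeAll≡true⁺ F i∉ Fi rewrite ∈?≡false i∉ | Fi = refl

  removeAll≡true⁻ : ∀ F A i → removeAll F A i ≡ true → F i ≡ true × i ∉ A
  removeAll≡true⁻ F A i p with F i | i ∈? A
  ... | true | no i∉ = refl , i∉

  restrict : EdgeSet → Colouring → Colouring
  restrict F φ = tabulate (λ i → if F i then lookup φ i else 0)

  lookup-restrict-∈ : ∀ F φ i → F i ≡ true → lookup (restrict F φ) i ≡ lookup φ i
  lookup-restrict-∈ F φ i p rewrite lookup∘tabulate (λ i → if F i then lookup φ i else 0) i | p = refl

  lookup-restrict-∉ : ∀ F φ i → F i ≡ false → lookup (restrict F φ) i ≡ 0
  lookup-restrict-∉ F φ i p rewrite lookup∘tabulate (λ i → if F i then lookup φ i else 0) i | p = refl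

  SquareIn-reverse : ∀ F φ A B → SquareIn F φ (A , B) → SquareIn F φ (reverse B , reverse A)
  SquareIn-reverse F φ A B (u , inF , sq) =
    subst Unique (reverse-++ A B) (Unique-reverse⁺ u) ,
    All.tabulate (λ i∈ → All.lookup inF (swap-∈ (∈-++⁻ (reverse B) i∈))) ,
    trans (reverse-map (lookup φ) B) (trans (cong reverse (sym sq)) (sym (reverse-map (lookup φ) A)))
    where
    swap-∈ : ∀ {i} → i ∈ reverse B ⊎ i ∈ reverse A → i ∈ A ++ B
    swap-∈ (inj₁ i∈) = ∈-++⁺ʳ A (AnyP.reverse⁻ {xs = B} i∈)
    swap-∈ (inj₂ i∈) = ∈-++⁺ˡ (AnyP.reverse⁻ {xs = A} i∈)

  badExtensionsOn : EdgeSet → Fin m → List (Fin m) × List (Fin m) → List Colouring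
  badExtensionsOn F e AB = filter (λ φ → SquareIn? (insert F e) φ AB) (extensions F e)

  badExtensionsAt : EdgeSet → Fin m → ℕ → List Colouring
  badExtensionsAt F e k = concatMap (badExtensionsOn F e) (squareWalksThrough e k)

  badExtensionsBelow : EdgeSet → Fin m → ℕ → List Colouring
  badExtensionsBelow F e zero = []
  badExtensionsBelow F e (suc K) = badExtensionsBelow F e K ++ badExtensionsAt F e K

  ∈-badExtensionsBelow : ∀ F e {k K φ} → k < K → φ ∈ badExtensionsAt F e k → φ ∈ badExtensionsBelow F e K
  ∈-badExtensionsBelow F e {K = suc K} (s≤s k≤K) φ∈ with m≤n⇒m<n∨m≡n k≤K
  ... | inj₁ k<K = ∈-++⁺ˡ (∈-badExtensionsBelow F e k<K φ∈)
  ... | inj₂ refl = ∈-++⁺ʳ (badExtensionsBelow F e K) φ∈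

  ∈-badExtensionsAt : ∀ F e {k AB φ} → AB ∈ squareWalksThrough e k → φ ∈ extensions F e →
    SquareIn (insert F e) φ AB → φ ∈ badExtensionsAt F e k
  ∈-badExtensionsAt F e {AB = AB} AB∈ φ∈ sq =
    ∈-concatMap⁺′ (badExtensionsOn F e) AB∈ (∈-filter⁺ (λ φ → SquareIn? (insert F e) φ AB) φ∈ sq)

  -- Otherwise the square would already be present in the colouring of F that φ extends.
  extension-square-uses-e : ∀ F e {φ A B} → φ ∈ extensions F e → (A , B) ∈ candidateSquares →
    SquareIn (insert F e) φ (A , B) → e ∈ A ++ B
  extension-square-uses-e F e {φ} {A} {B} φ∈ AB∈ sq@(_ , inF , _) with e ∈? (A ++ B) | ∈-extensions⁻ φ∈
  ... | yes e∈ | _ = e∈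
  ... | no e∉ | ψ , x , ψ∈ , _ , refl = ⊥-elim (All.lookup (proj₂ (∈-goodColourings⁻ ψ∈)) AB∈
    (SquareIn-transfer {φ = ψ [ e ]≔ x} {ψ} {A} {B} sq (All.tabulate (λ i∈ → trans (sym (insert-≢ F (≢e i∈))) (All.lookup inF i∈)))
                          (All.tabulate (λ i∈ → lookup∘update′ (≢e i∈) ψ x))))
    where
    ≢e : ∀ {i} → i ∈ A ++ B → i ≢ e
    ≢e i∈ refl = e∉ i∈

  -- A square through e can be read backwards, so that e lies in its first half.
  SquareIn-through : ∀ {F φ e e′ k A B} → SquareWalk e′ k (A , B) → SquareIn F φ (A , B) → e ∈ A ⊎ e ∈ B →
    ∃ λ AB → AB ∈ squareWalksThrough e k × SquareIn F φ AB
  SquareIn-through {e = e} {k = k} {A} {B} ((x , y , walk) , lA , lB , _) sq (inj₁ e∈A) =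
    (A , B) , ∈-squareWalksThrough⁺ e k A B walk lA lB e∈A , sq
  SquareIn-through {F} {φ} {e} {k = k} {A} {B} ((x , y , walk) , lA , lB , _) sq (inj₂ e∈B) =
    (reverse B , reverse A) ,
    ∈-squareWalksThrough⁺ e k (reverse B) (reverse A) (subst (λ es → Walk y es x) (reverse-++ A B) (Walk-reverse walk))
      (trans (length-reverse B) lB) (trans (length-reverse A) lA) (AnyP.reverse⁺ e∈B) ,
    SquareIn-reverse F φ A B sq

  badExtension∈badExtensionsBelow : ∀ F e {φ} → φ ∈ extensions F e → ¬ SquareFree (insert F e) φ →
    φ ∈ badExtensionsBelow F e m
  badExtension∈badExtensionsBelow F e {φ} φ∈ ¬free =
    let (A , B) , AB∈ , sq = ¬SquareFree⇒SquareIn (insert F e) φ ¬free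
        e′ , k , k<m , AB∈′ = ∈-candidateSquares⁻ AB∈
        AB′ , AB′∈ , sq′ = SquareIn-through {insert F e} {φ} {e} {e′} {k} (∈-squareWalksThrough⁻ e′ k AB∈′) sq
                             (∈-++⁻ A (extension-square-uses-e F e {φ} {A} {B} φ∈ AB∈ sq))
    in ∈-badExtensionsBelow F e k<m (∈-badExtensionsAt F e {k} AB′∈ φ∈ sq′)

  module Uncolouring (F : EdgeSet) (e : Fin m) (Fe : F e ≡ false) (A B : List (Fin m)) (e∈A : e ∈ A)
                     (u : Unique (A ++ B)) (inF : (A ++ B) ⊆ₑ insert F e) where

    F∖A : EdgeSet
    F∖A = removeAll F A

    A∖e : List (Fin m)
    A∖e = filter (λ i → ¬? (i ≟ e)) A

    F-true⇒≢e : ∀ {i} → F i ≡ true → i ≢ e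
    F-true⇒≢e Fi refl with trans (sym Fe) Fi
    ... | ()

    B⊆F∖A : ∀ {j} → j ∈ B → F∖A j ≡ true
    B⊆F∖A {j} j∈B = removeAll≡true⁺ F j∉A (trans (sym (insert-≢ F j≢e)) (All.lookup inF (∈-++⁺ʳ A j∈B)))
      where
      j∉A : j ∉ A
      j∉A j∈A = Unique-++⇒disjoint A u j∈A j∈B
      j≢e : j ≢ e
      j≢e refl = j∉A e∈A

    restrict-agree : ∀ {φ φ′} → restrict F∖A φ ≡ restrict F∖A φ′ → ∀ {i} → F∖A i ≡ true → lookup φ i ≡ lookup φ′ i
    restrict-agree {φ} {φ′} eq {i} p =
      trans (sym (lookup-restrict-∈ F∖A φ i p)) (trans (cong (λ χ → lookup χ i) eq) (lookup-restrict-∈ F∖A φ′ i p))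

    -- On A a bad colouring copies its colours from B ⊆ F∖A, and outside F ∪ {e} it is 0.
    restrict-injective : ∀ {φ φ′} → φ ∈ badExtensionsOn F e (A , B) → φ′ ∈ badExtensionsOn F e (A , B) →
      restrict F∖A φ ≡ restrict F∖A φ′ → φ ≡ φ′
    restrict-injective {φ} {φ′} φ∈ φ′∈ eq = Pointwise-≡⇒≡ (ext agree)
      where
      bad = ∈-filter⁻ (λ φ → SquareIn? (insert F e) φ (A , B)) {xs = extensions F e} φ∈
      bad′ = ∈-filter⁻ (λ φ → SquareIn? (insert F e) φ (A , B)) {xs = extensions F e} φ′∈
      agree : ∀ i → lookup φ i ≡ lookup φ′ i
      agree i with i ∈? A
      ... | yes i∈A with map²-≡⇒partner (lookup φ) (lookup φ′) A B (proj₂ (proj₂ (proj₂ bad))) (proj₂ (proj₂ (proj₂ bad′))) i∈A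
      ...   | j , j∈B , φi≡φj , φ′i≡φ′j = trans φi≡φj (trans (restrict-agree {φ} {φ′} eq (B⊆F∖A j∈B)) (sym φ′i≡φ′j))
      agree i | no i∉A with F i in Fi
      ...   | true = restrict-agree {φ} {φ′} eq (removeAll≡true⁺ F i∉A Fi)
      ...   | false = trans (proj₂ (extension-FromLists Fe (proj₁ bad) i) outside)
                            (sym (proj₂ (extension-FromLists Fe (proj₁ bad′) i) outside))
        where
        outside : insert F e i ≡ false
        outside = trans (insert-≢ F (λ { refl → i∉A e∈A })) Fi

    restrict-∈goodColourings : ∀ {φ} → φ ∈ badExtensionsOn F e (A , B) → restrict F∖A φ ∈ goodColourings F∖A
    restrict-∈goodColourings φ∈ with ∈-filter⁻ (λ φ → SquareIn? (insert F e) φ (A , B)) {xs = extensions F e} φ∈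
    ... | φ∈ext , _ with ∈-extensions⁻ φ∈ext
    ... | ψ , x , ψ∈ , _ , refl = ∈-goodColourings⁺ from-lists square-free
      where
      from-lists : FromLists F∖A L (restrict F∖A (ψ [ e ]≔ x))
      from-lists i = (λ p → subst (_∈ L i) (sym (lookup-restrict-∈ F∖A (ψ [ e ]≔ x) i p))
                               (proj₁ (extension-FromLists Fe φ∈ext i)
                                 (trans (cong (⌊ i ≟ e ⌋ ∨_) (proj₁ (removeAll≡true⁻ F A i p))) (∨-zeroʳ _))))
                   , lookup-restrict-∉ F∖A (ψ [ e ]≔ x) i
      square-free : SquareFree F∖A (restrict F∖A (ψ [ e ]≔ x))
      square-free = SquareFree-mono F F∖A ψ (restrict F∖A (ψ [ e ]≔ x)) (proj₂ (∈-goodColourings⁻ ψ∈))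
        (λ i p → proj₁ (removeAll≡true⁻ F A i p))
        (λ i p → trans (lookup-restrict-∈ F∖A (ψ [ e ]≔ x) i p)
                       (lookup∘update′ (F-true⇒≢e (proj₁ (removeAll≡true⁻ F A i p))) ψ x))

    length-badExtensionsOn : length (badExtensionsOn F e (A , B)) ≤ count F∖A
    length-badExtensionsOn =
      subst (_≤ count F∖A) (length-map (restrict F∖A) (badExtensionsOn F e (A , B)))
        (Unique-⊆⇒length≤
          (Unique-map⁺-on (restrict F∖A) (UniqueP.filter⁺ _ (Unique-extensions F e Fe)) restrict-injective)
          (λ χ∈ → case-∈ (∈-map⁻ (restrict F∖A) χ∈)))
      where
      case-∈ : ∀ {χ} → (∃ λ φ → φ ∈ badExtensionsOn F e (A , B) × χ ≡ restrict F∖A φ) → χ ∈ goodColourings F∖A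
      case-∈ (φ , φ∈ , refl) = restrict-∈goodColourings φ∈

    Unique-A∖e : Unique A∖e
    Unique-A∖e = UniqueP.filter⁺ _ (Unique-++⁻ˡ A u)

    A∖e-outside : All (λ h → F∖A h ≡ false) A∖e
    A∖e-outside = All.tabulate (λ h∈ → removeAll-∈ F (proj₁ (∈-filter⁻ (λ i → ¬? (i ≟ e)) {xs = A} h∈)))

    addAll-A∖e⊆F : ∀ i → addAll F∖A A∖e i ≡ true → F i ≡ true
    addAll-A∖e⊆F i p with addAll≡true⁻ F∖A A∖e i p
    ... | inj₁ q = proj₁ (removeAll≡true⁻ F A i q)
    ... | inj₂ i∈ with ∈-filter⁻ (λ i → ¬? (i ≟ e)) {xs = A} i∈
    ...   | i∈A , i≢e = trans (sym (insert-≢ F i≢e)) (All.lookup inF (∈-++⁺ˡ i∈A))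

    addAll-A∖e≡F : ∀ i → addAll F∖A A∖e i ≡ F i
    addAll-A∖e≡F i = ≡true-ext (addAll-A∖e⊆F i) F⊆
      where
      F⊆ : F i ≡ true → addAll F∖A A∖e i ≡ true
      F⊆ Fi = by-cases (i ∈? A)
        where
        by-cases : Dec (i ∈ A) → addAll F∖A A∖e i ≡ true
        by-cases (yes i∈A) = addAll-∈ F∖A (∈-filter⁺ (λ i → ¬? (i ≟ e)) i∈A (F-true⇒≢e Fi))
        by-cases (no i∉A) = addAll-⊇ F∖A A∖e (removeAll≡true⁺ F i∉A Fi)

    length-A≤1+length-A∖e : length A ≤ suc (length A∖e)
    length-A≤1+length-A∖e = begin
      length A                          ≡⟨ length-filter+length-filter∁ (λ i → ¬? (i ≟ e)) A ⟩
      length A∖e + length copies-of-e           ≤⟨ +-monoʳ-≤ (length A∖e)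
                                                     (Unique-All≡⇒length≤1 e (UniqueP.filter⁺ _ (Unique-++⁻ˡ A u)) all≡e) ⟩
      length A∖e + 1                    ≡⟨ +-comm (length A∖e) 1 ⟩
      suc (length A∖e)                  ∎
      where
      open ≤-Reasoning
      copies-of-e = filter (∁? (λ i → ¬? (i ≟ e))) A
      all≡e : All (_≡ e) copies-of-e
      all≡e = All.tabulate λ i∈ → decidable-stable (_ ≟ e) (proj₂ (∈-filter⁻ (∁? (λ i → ¬? (i ≟ e))) {xs = A} i∈))

  full : EdgeSet
  full _ = true

  SquareFree-full⇒empty-half : ∀ {φ x y} E₂ E₃ → SquareFree full φ → Walk x (E₂ ++ E₃) y → Unique (E₂ ++ E₃) →
    map (lookup φ) E₂ ≡ map (lookup φ) E₃ → E₂ ≡ []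
  SquareFree-full⇒empty-half [] E₃ _ _ _ _ = refl
  SquareFree-full⇒empty-half {φ} (e₀ ∷ E₂) E₃ free walk u sq =
    ⊥-elim (All.lookup free (∈-candidateSquares⁺ k<m AB∈) (u , All.tabulate (λ _ → refl) , sq))
    where
    equal-halves : length (e₀ ∷ E₂) ≡ length E₃
    equal-halves = trans (sym (length-map (lookup φ) (e₀ ∷ E₂))) (trans (cong length sq) (length-map (lookup φ) E₃))
    AB∈ : (e₀ ∷ E₂ , E₃) ∈ squareWalksThrough e₀ (length E₂)
    AB∈ = ∈-squareWalksThrough⁺ e₀ (length E₂) (e₀ ∷ E₂) E₃ walk refl (sym equal-halves) (here refl)
    k<m : length E₂ < m
    k<m = ≤-trans (subst (length (e₀ ∷ E₂) ≤_) (sym (length-++ (e₀ ∷ E₂))) (m≤m+n _ (length E₃))) (Unique⇒length≤m u)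

  SquareFree-full⇒empty-factor : ∀ {φ x y} E₁ E₂ E₃ E₄ → SquareFree full φ → Walk x (E₁ ++ (E₂ ++ (E₃ ++ E₄))) y →
    Unique (E₁ ++ (E₂ ++ (E₃ ++ E₄))) → map (lookup φ) E₂ ≡ map (lookup φ) E₃ → E₂ ≡ []
  SquareFree-full⇒empty-factor {φ} E₁ E₂ E₃ E₄ free walk u sq with Walk-++⁻ E₁ walk
  ... | _ , _ , walk₂₃₄ with Walk-++⁻ E₂ walk₂₃₄
  ... | _ , walk₂ , walk₃₄ with Walk-++⁻ E₃ walk₃₄
  ... | _ , walk₃ , _ =
    SquareFree-full⇒empty-half {φ} E₂ E₃ free (Walk-++ walk₂ walk₃)
      (Unique-++⁻ˡ (E₂ ++ E₃) (subst Unique (sym (++-assoc E₂ E₃ E₄)) (Unique-++⁻ʳ E₁ u))) sq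

  SquareFree-full⇒NonRepColoring : ∀ φ → SquareFree full φ → NonRepColoring G (lookup φ)
  SquareFree-full⇒NonRepColoring φ free [] es (() , _)
  SquareFree-full⇒NonRepColoring φ free (v ∷ vs) es path@(iw , _) (ys , zs , ws , zs≢[] , colours≡)
    with map-++⁻ (lookup φ) es ys (zs ++ (zs ++ ws)) colours≡
  ... | E₁ , R₁ , es≡ , _ , eq₁ with map-++⁻ (lookup φ) R₁ zs (zs ++ ws) eq₁
  ... | E₂ , R₂ , R₁≡ , eq₂ , eq₂′ with map-++⁻ (lookup φ) R₂ zs ws eq₂′
  ... | E₃ , E₄ , R₂≡ , eq₃ , _ =
    zs≢[] (trans (sym eq₂) (cong (map (lookup φ))
      (SquareFree-full⇒empty-factor {φ} E₁ E₂ E₃ E₄ free (subst (λ es → Walk v es (proj₁ (IsWalk⇒Walk iw))) es≡′ (proj₂ (IsWalk⇒Walk iw)))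
        (subst Unique es≡′ (IsPath⇒Unique-edges path)) (trans eq₂ (sym eq₃)))))
    where
    es≡′ : es ≡ E₁ ++ (E₂ ++ (E₃ ++ E₄))
    es≡′ = trans es≡ (cong (E₁ ++_) (trans R₁≡ (cong (E₂ ++_) R₂≡)))

  module Growth {Δ} (degΔ : ∀ v → degree G v ≤ Δ) {l} (L-long : ∀ e → l ≤ length (L e))
                (c : ℕ) .{{_ : NonZero c}} (c≤l : c ≤ l)
                (series : ∀ K → scaledSeries Δ c (suc K) ≤ c ^ K * (l ∸ c)) where

    GrowsBelow : ℕ → Set
    GrowsBelow s = ∀ F → size F < s → ∀ h → F h ≡ false → c * count F ≤ count (insert F h)

    insert-addAll : ∀ F hs h i → insert (addAll F hs) h i ≡ addAll F (h ∷ hs) i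
    insert-addAll F hs h i = ≡true-ext to from
      where
      to : insert (addAll F hs) h i ≡ true → addAll F (h ∷ hs) i ≡ true
      to p with insert≡true⁻ (addAll F hs) h i p
      ... | inj₁ refl = addAll-∈ F (here refl)
      ... | inj₂ q with addAll≡true⁻ F hs i q
      ...   | inj₁ Fi = addAll-⊇ F (h ∷ hs) Fi
      ...   | inj₂ i∈ = addAll-∈ F (there i∈)
      from : addAll F (h ∷ hs) i ≡ true → insert (addAll F hs) h i ≡ true
      from p with i ≟ h | addAll≡true⁻ F (h ∷ hs) i p
      ... | yes _ | _ = refl
      ... | no _ | inj₁ Fi = addAll-⊇ F hs Fi
      ... | no i≢h | inj₂ (here i≡h) = ⊥-elim (i≢h i≡h)
      ... | no _ | inj₂ (there i∈) = addAll-∈ F i∈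

    count-addAll : ∀ {s} → GrowsBelow s → ∀ F → size F ≤ s → ∀ F′ hs → Unique hs → All (λ h → F′ h ≡ false) hs →
      (∀ i → addAll F′ hs i ≡ true → F i ≡ true) → c ^ length hs * count F′ ≤ count (addAll F′ hs)
    count-addAll grows F sF F′ [] _ _ _ =
      ≤-reflexive (trans (*-identityˡ (count F′)) (count-cong F′ (addAll F′ []) (λ i → sym (∨-identityʳ (F′ i)))))
    count-addAll grows F sF F′ (h ∷ hs) (h∉hs ∷ u) (F′h ∷ outside) ⊆F = begin
      c ^ suc (length hs) * count F′    ≡⟨ *-assoc c (c ^ length hs) (count F′) ⟩
      c * (c ^ length hs * count F′)    ≤⟨ *-monoʳ-≤ c (count-addAll grows F sF F′ hs u outside Y⊆F) ⟩
      c * count Y                       ≤⟨ grows Y (<-≤-trans (size-< Y F h Y⊆F Fh Yh) sF) h Yh ⟩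
      count (insert Y h)                ≡⟨ count-cong (insert Y h) (addAll F′ (h ∷ hs)) (insert-addAll F′ hs h) ⟩
      count (addAll F′ (h ∷ hs))        ∎
      where
      open ≤-Reasoning
      Y = addAll F′ hs
      Yh : Y h ≡ false
      Yh rewrite F′h | ∈?≡false {xs = hs} (λ h∈ → All.lookup h∉hs h∈ refl) = refl
      Y⊆F : ∀ i → Y i ≡ true → F i ≡ true
      Y⊆F i p = ⊆F i (trans (sym (insert-addAll F′ hs h i)) (trans (cong (⌊ i ≟ h ⌋ ∨_) p) (∨-zeroʳ _)))
      Fh : F h ≡ true
      Fh = ⊆F h (addAll-∈ F′ (here refl))

    -- Uncolouring the first half of the square costs a factor c for each edge of A other than e.
    c^k*length-badExtensionsOn : ∀ {s} → GrowsBelow s → ∀ F → size F ≤ s → ∀ e → F e ≡ false → ∀ k AB →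
      AB ∈ squareWalksThrough e k → c ^ k * length (badExtensionsOn F e AB) ≤ count F
    c^k*length-badExtensionsOn grows F sF e Fe k (A , B) AB∈ = by-cases (badExtensionsOn F e (A , B)) refl
      where
      walk-facts = ∈-squareWalksThrough⁻ e k AB∈
      e∈A = proj₂ (proj₂ (proj₂ walk-facts))
      lA = proj₁ (proj₂ walk-facts)
      with-witness : ∀ {φ₀} → φ₀ ∈ badExtensionsOn F e (A , B) → c ^ k * length (badExtensionsOn F e (A , B)) ≤ count F
      with-witness φ₀∈ = begin
        c ^ k * length (badExtensionsOn F e (A , B))  ≤⟨ *-monoʳ-≤ (c ^ k) U.length-badExtensionsOn ⟩
        c ^ k * count U.F∖A                            ≤⟨ *-monoˡ-≤ (count U.F∖A) (^-monoʳ-≤ c k≤) ⟩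
        c ^ length U.A∖e * count U.F∖A                 ≤⟨ count-addAll grows F sF U.F∖A U.A∖e U.Unique-A∖e U.A∖e-outside U.addAll-A∖e⊆F ⟩
        count (addAll U.F∖A U.A∖e)                     ≡⟨ count-cong (addAll U.F∖A U.A∖e) F U.addAll-A∖e≡F ⟩
        count F                                        ∎
        where
        open ≤-Reasoning
        sq = proj₂ (∈-filter⁻ (λ φ → SquareIn? (insert F e) φ (A , B)) {xs = extensions F e} φ₀∈)
        module U = Uncolouring F e Fe A B e∈A (proj₁ sq) (proj₁ (proj₂ sq))
        k≤ : k ≤ length U.A∖e
        k≤ = ≤-pred (subst (_≤ suc (length U.A∖e)) lA U.length-A≤1+length-A∖e)
      by-cases : ∀ φs → badExtensionsOn F e (A , B) ≡ φs → c ^ k * length (badExtensionsOn F e (A , B)) ≤ count F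
      by-cases [] eq rewrite eq | *-zeroʳ (c ^ k) = z≤n
      by-cases (φ₀ ∷ _) eq = with-witness (subst (φ₀ ∈_) (sym eq) (here refl))

    c^k*length-badExtensionsAt : ∀ {s} → GrowsBelow s → ∀ F → size F ≤ s → ∀ e → F e ≡ false → ∀ k →
      c ^ k * length (badExtensionsAt F e k) ≤ squareWalkBound Δ k * count F
    c^k*length-badExtensionsAt grows F sF e Fe k =
      ≤-trans (*-length-concatMap-≤ (badExtensionsOn F e) (c ^ k) (count F) (squareWalksThrough e k)
                (c^k*length-badExtensionsOn grows F sF e Fe k _))
              (*-monoˡ-≤ (count F) (length-squareWalksThrough degΔ e k))

    c^K*length-badExtensionsBelow : ∀ F e → (∀ k → c ^ k * length (badExtensionsAt F e k) ≤ squareWalkBound Δ k * count F) →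
      ∀ K → c ^ K * length (badExtensionsBelow F e (suc K)) ≤ scaledSeries Δ c (suc K) * count F
    c^K*length-badExtensionsBelow F e at-k zero =
      subst (λ t → 1 * length (badExtensionsAt F e 0) ≤ (t + squareWalkBound Δ 0) * count F) (sym (*-zeroʳ c)) (at-k 0)
    c^K*length-badExtensionsBelow F e at-k (suc K) = begin
      c ^ suc K * length (badExtensionsBelow F e (suc K) ++ badExtensionsAt F e (suc K))
        ≡⟨ cong (c ^ suc K *_) (length-++ (badExtensionsBelow F e (suc K))) ⟩
      c ^ suc K * (length (badExtensionsBelow F e (suc K)) + length (badExtensionsAt F e (suc K)))
        ≡⟨ *-distribˡ-+ (c ^ suc K) _ _ ⟩
      c * c ^ K * length (badExtensionsBelow F e (suc K)) + c ^ suc K * length (badExtensionsAt F e (suc K))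
        ≡⟨ cong (_+ c ^ suc K * length (badExtensionsAt F e (suc K))) (*-assoc c (c ^ K) _) ⟩
      c * (c ^ K * length (badExtensionsBelow F e (suc K))) + c ^ suc K * length (badExtensionsAt F e (suc K))
        ≤⟨ +-mono-≤ (*-monoʳ-≤ c (c^K*length-badExtensionsBelow F e at-k K)) (at-k (suc K)) ⟩
      c * (scaledSeries Δ c (suc K) * count F) + squareWalkBound Δ (suc K) * count F
        ≡⟨ cong (_+ squareWalkBound Δ (suc K) * count F) (sym (*-assoc c (scaledSeries Δ c (suc K)) (count F))) ⟩
      c * scaledSeries Δ c (suc K) * count F + squareWalkBound Δ (suc K) * count F
        ≡⟨ sym (*-distribʳ-+ (count F) (c * scaledSeries Δ c (suc K)) (squareWalkBound Δ (suc K))) ⟩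
      scaledSeries Δ c (suc (suc K)) * count F ∎
      where open ≤-Reasoning

    count-insert-step : ∀ {s} → GrowsBelow s → ∀ F → size F ≤ s → ∀ e → F e ≡ false → c * count F ≤ count (insert F e)
    count-insert-step {s} grows F sF e Fe = excess-bound c≤l total (*-cancelˡ-≤ (c ^ K) {{m^n≢0 c K}} bad-bound)
      where
      K = m ∸ 1
      E = extensions F e
      good = filter (SquareFree? (insert F e)) E
      bad = filter (∁? (SquareFree? (insert F e))) E
      Unique-E = Unique-extensions F e Fe
      m≡1+K : m ≡ suc K
      m≡1+K = inhabited e
        where
        inhabited : ∀ {k} → Fin k → k ≡ suc (k ∸ 1)
        inhabited {suc k} _ = refl
      length-good : length good ≤ count (insert F e)
      length-good = Unique-⊆⇒length≤ (UniqueP.filter⁺ _ Unique-E) λ φ∈ →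
        let φ∈E , free = ∈-filter⁻ (SquareFree? (insert F e)) {xs = E} φ∈
        in ∈-goodColourings⁺ (extension-FromLists Fe φ∈E) free
      length-bad : length bad ≤ length (badExtensionsBelow F e (suc K))
      length-bad = Unique-⊆⇒length≤ (UniqueP.filter⁺ _ Unique-E) λ φ∈ →
        let φ∈E , ¬free = ∈-filter⁻ (∁? (SquareFree? (insert F e))) {xs = E} φ∈
        in subst (λ M → _ ∈ badExtensionsBelow F e M) m≡1+K (badExtension∈badExtensionsBelow F e φ∈E ¬free)
      total : count F * l ≤ count (insert F e) + length bad
      total = begin
        count F * l                      ≤⟨ *-monoʳ-≤ (count F) (L-long e) ⟩
        count F * length (L e)           ≡⟨ sym (length-extensions F e) ⟩
        length E                         ≡⟨ length-filter+length-filter∁ (SquareFree? (insert F e)) E ⟩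
        length good + length bad         ≤⟨ +-monoˡ-≤ (length bad) length-good ⟩
        count (insert F e) + length bad  ∎
        where open ≤-Reasoning
      bad-bound : c ^ K * length bad ≤ c ^ K * ((l ∸ c) * count F)
      bad-bound = begin
        c ^ K * length bad                                      ≤⟨ *-monoʳ-≤ (c ^ K) length-bad ⟩
        c ^ K * length (badExtensionsBelow F e (suc K))          ≤⟨ c^K*length-badExtensionsBelow F e
                                                                     (c^k*length-badExtensionsAt grows F sF e Fe) K ⟩
        scaledSeries Δ c (suc K) * count F                      ≤⟨ *-monoˡ-≤ (count F) (series K) ⟩
        c ^ K * (l ∸ c) * count F                               ≡⟨ *-assoc (c ^ K) (l ∸ c) (count F) ⟩
        c ^ K * ((l ∸ c) * count F)                             ∎
        where open ≤-Reasoning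

    count-insert : ∀ s → GrowsBelow s
    count-insert (suc s) F (s≤s sF) h Fh = count-insert-step (count-insert s) F sF h Fh

    empty : EdgeSet
    empty _ = false

    1≤count-empty : 1 ≤ count empty
    1≤count-empty = ∈-length (∈-goodColourings⁺ {empty} {zeros} from-lists square-free)
      where
      zeros : Colouring
      zeros = tabulate (λ _ → 0)
      from-lists : FromLists empty L zeros
      from-lists i = (λ ()) , (λ _ → lookup∘tabulate (λ _ → 0) i)
      nonempty-outside : ∀ {A B k} → length A ≡ suc k → ¬ (A ++ B) ⊆ₑ empty
      nonempty-outside {_ ∷ _} _ (() ∷ _)
      square-free : SquareFree empty zeros
      square-free = All.tabulate λ {(A , B)} AB∈ (_ , inF , _) →
        let e , k , _ , AB∈′ = ∈-candidateSquares⁻ AB∈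
        in nonempty-outside {A} {B} (proj₁ (proj₂ (∈-squareWalksThrough⁻ e k AB∈′))) inF

    1≤count-full : 1 ≤ count full
    1≤count-full = begin
      1                                  ≤⟨ 1≤count-empty ⟩
      count empty                        ≤⟨ m≤n*m (count empty) (c ^ length (allFin m)) {{m^n≢0 c (length (allFin m))}} ⟩
      c ^ length (allFin m) * count empty ≤⟨ count-addAll (count-insert (size full)) full ≤-refl empty (allFin m)
                                              (UniqueP.allFin⁺ m) (All.tabulate (λ _ → refl)) (λ _ _ → refl) ⟩
      count (addAll empty (allFin m))    ≡⟨ count-cong (addAll empty (allFin m)) full (λ i → ∈?≡true (∈-allFin i)) ⟩
      count full                         ∎
      where open ≤-Reasoning

    choosable : ∃[ col ] ((∀ e → col e ∈ L e) × NonRepColoring G col)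
    choosable = from-member (nonempty (goodColourings full) 1≤count-full)
      where
      nonempty : ∀ {A : Set} (xs : List A) → 1 ≤ length xs → ∃ (_∈ xs)
      nonempty (x ∷ _) _ = x , here refl
      from-member : ∃ (_∈ goodColourings full) → ∃[ col ] ((∀ e → col e ∈ L e) × NonRepColoring G col)
      from-member (φ , φ∈) =
        let from-lists , free = ∈-goodColourings⁻ φ∈
        in lookup φ , (λ e → proj₁ (from-lists e) refl) , SquareFree-full⇒NonRepColoring φ free

-- Σ_{k<K} (k+1) y^k c^(K-1-k)
powerSum : ℕ → ℕ → ℕ → ℕ
powerSum c y zero = 0
powerSum c y (suc K) = c * powerSum c y K + suc K * y ^ K

^-square : ∀ Δ K → (Δ * Δ) ^ K ≡ Δ ^ K * Δ ^ K
^-square Δ zero = refl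
^-square Δ (suc K) rewrite ^-square Δ K =
  solve 3 (λ D a b → (D :* D) :* (a :* b) := (D :* a) :* (D :* b)) refl Δ (Δ ^ K) (Δ ^ K)

^-odd : ∀ Δ K → Δ ^ (K + suc K) ≡ Δ * (Δ * Δ) ^ K
^-odd Δ K rewrite ^-distribˡ-+-* Δ K (suc K) | ^-square Δ K =
  solve 2 (λ D a → a :* (D :* a) := D :* (a :* a)) refl Δ (Δ ^ K)

scaledSeries≡powerSum : ∀ Δ c K → scaledSeries Δ c K ≡ 2 * Δ * powerSum c (Δ * Δ) K
scaledSeries≡powerSum Δ c zero = solve 1 (λ D → con 0 := con 2 :* D :* con 0) refl Δ
scaledSeries≡powerSum Δ c (suc K) rewrite scaledSeries≡powerSum Δ c K | ^-odd Δ K =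
  solve 5 (λ c D u k w → c :* (con 2 :* D :* u) :+ con 2 :* ((con 1 :+ k) :* (D :* w))
                       := con 2 :* D :* (c :* u :+ (con 1 :+ k) :* w)) refl c Δ (powerSum c (Δ * Δ) K) K ((Δ * Δ) ^ K)

-- The closed form of Σ_k (k+1) y^k (y+d)^(K-1-k), with denominators cleared.
powerSum-identity : ∀ y d K → powerSum (y + d) y K * (d * d) + suc K * y ^ K * (y + d) ≡ (y + d) ^ suc K + K * (y * y ^ K)
powerSum-identity y d zero =
  solve 2 (λ y d → con 0 :* (d :* d) :+ con 1 :* con 1 :* (y :+ d) := (y :+ d) :* con 1 :+ con 0 :* (y :* con 1)) refl y d
powerSum-identity y d (suc K) = +-cancelʳ-≡ (c * (suc K * Y * c)) _ _ (begin
  (c * S + suc K * Y) * (d * d) + suc (suc K) * (y * Y) * c + c * (suc K * Y * c)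
    ≡⟨ solve 5 (λ y d u k Y → ((y :+ d) :* u :+ (con 1 :+ k) :* Y) :* (d :* d) :+ (con 2 :+ k) :* (y :* Y) :* (y :+ d)
                               :+ (y :+ d) :* ((con 1 :+ k) :* Y :* (y :+ d))
              := (y :+ d) :* (u :* (d :* d) :+ (con 1 :+ k) :* Y :* (y :+ d))
                   :+ ((con 1 :+ k) :* Y :* (d :* d) :+ (con 2 :+ k) :* (y :* Y) :* (y :+ d))) refl y d S K Y ⟩
  c * (S * (d * d) + suc K * Y * c) + (suc K * Y * (d * d) + suc (suc K) * (y * Y) * c)
    ≡⟨ cong (λ t → c * t + (suc K * Y * (d * d) + suc (suc K) * (y * Y) * c)) (powerSum-identity y d K) ⟩
  c * (c ^ suc K + K * (y * Y)) + (suc K * Y * (d * d) + suc (suc K) * (y * Y) * c)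
    ≡⟨ solve 5 (λ y d P k Y → (y :+ d) :* ((y :+ d) :* P :+ k :* (y :* Y))
                               :+ ((con 1 :+ k) :* Y :* (d :* d) :+ (con 2 :+ k) :* (y :* Y) :* (y :+ d))
              := (y :+ d) :* ((y :+ d) :* P) :+ (con 1 :+ k) :* (y :* (y :* Y)) :+ (y :+ d) :* ((con 1 :+ k) :* Y :* (y :+ d)))
              refl y d (c ^ K) K Y ⟩
  c * c ^ suc K + suc K * (y * (y * Y)) + c * (suc K * Y * c) ∎)
  where
  open ≡-Reasoning
  c = y + d
  Y = y ^ K
  S = powerSum c y K

powerSum-bound : ∀ y d K → powerSum (y + d) y K * (d * d) ≤ (y + d) ^ suc K
powerSum-bound y d K = +-cancelʳ-≤ (suc K * y ^ K * c) _ _ (begin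
  powerSum c y K * (d * d) + suc K * y ^ K * c ≡⟨ powerSum-identity y d K ⟩
  c ^ suc K + K * (y * y ^ K)                 ≡⟨ cong (c ^ suc K +_) (solve 3 (λ k y Y → k :* (y :* Y) := k :* Y :* y) refl K y (y ^ K)) ⟩
  c ^ suc K + K * y ^ K * y                   ≤⟨ +-monoʳ-≤ (c ^ suc K) (*-mono-≤ (*-monoˡ-≤ (y ^ K) (n≤1+n K)) (m≤m+n y d)) ⟩
  c ^ suc K + suc K * y ^ K * c               ∎)
  where
  open ≤-Reasoning
  c = y + d

-- Σ_k (k+1) (y/c)^k ≤ (c/d)² for c = y + d, applied with y = Δ².
scaledSeries-bound : ∀ Δ d l → 1 ≤ d → 2 * Δ * ((Δ * Δ + d) * (Δ * Δ + d)) ≤ (l ∸ (Δ * Δ + d)) * (d * d) →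
  ∀ K → scaledSeries Δ (Δ * Δ + d) (suc K) ≤ (Δ * Δ + d) ^ K * (l ∸ (Δ * Δ + d))
scaledSeries-bound Δ d@(suc _) l _ key K = *-cancelʳ-≤ _ _ (d * d) (begin
  scaledSeries Δ c (suc K) * (d * d)         ≡⟨ cong (_* (d * d)) (scaledSeries≡powerSum Δ c (suc K)) ⟩
  2 * Δ * powerSum c y (suc K) * (d * d)     ≡⟨ *-assoc (2 * Δ) _ _ ⟩
  2 * Δ * (powerSum c y (suc K) * (d * d))   ≤⟨ *-monoʳ-≤ (2 * Δ) (powerSum-bound y d (suc K)) ⟩
  2 * Δ * (c ^ suc (suc K))                  ≡⟨ solve 3 (λ a c P → a :* (c :* (c :* P)) := P :* (a :* (c :* c))) refl (2 * Δ) c (c ^ K) ⟩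
  c ^ K * (2 * Δ * (c * c))                  ≤⟨ *-monoʳ-≤ (c ^ K) key ⟩
  c ^ K * ((l ∸ c) * (d * d))                ≡⟨ sym (*-assoc (c ^ K) (l ∸ c) (d * d)) ⟩
  c ^ K * (l ∸ c) * (d * d)                  ∎)
  where
  open ≤-Reasoning
  y = Δ * Δ
  c = y + d

ℕ→ℚ-mkℚ : ∀ k → ℕ→ℚ k ≡ mkℚ (ℤ.+ k) 0 (Coprimality.sym (Coprimality.1-coprimeTo k))
ℕ→ℚ-mkℚ k = ℚP.normalize-coprime (Coprimality.sym (Coprimality.1-coprimeTo k))

ℕ→ℚ-* : ∀ a b → ℕ→ℚ a ℚ.* ℕ→ℚ b ≡ ℕ→ℚ (a * b)
ℕ→ℚ-* a b rewrite ℕ→ℚ-mkℚ a | ℕ→ℚ-mkℚ b = cong (_/ 1) (sym (ℤP.pos-* a b))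

ℕ→ℚ-+ : ∀ a b → ℕ→ℚ a ℚ.+ ℕ→ℚ b ≡ ℕ→ℚ (a + b)
ℕ→ℚ-+ a b rewrite ℕ→ℚ-mkℚ a | ℕ→ℚ-mkℚ b | ℤP.*-identityʳ (ℤ.+ a) | ℤP.*-identityʳ (ℤ.+ b) =
  cong (_/ 1) (sym (ℤP.pos-+ a b))

ℕ→ℚ-mono-≤ : ∀ {a b} → a ≤ b → ℕ→ℚ a ℚ.≤ ℕ→ℚ b
ℕ→ℚ-mono-≤ {a} {b} a≤b rewrite ℕ→ℚ-mkℚ a | ℕ→ℚ-mkℚ b =
  ℚ.*≤* (subst₂ ℤ._≤_ (sym (ℤP.*-identityʳ (ℤ.+ a))) (sym (ℤP.*-identityʳ (ℤ.+ b))) (ℤ.+≤+ a≤b))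

cube : ℕ → ℕ
cube x = x * x * x

BelowBound-ℕ : ∀ Δ l p q → 2 * cube p ≤ 27 * Δ ^ 5 → cube q ≤ 512 * Δ ^ 4 → l ≤ Δ * Δ + 1 + p + q → BelowBound Δ l
BelowBound-ℕ Δ l p q p-bound q-bound l-bound = ℕ→ℚ p , ℕ→ℚ q , 0≤ℕ→ℚ p , 0≤ℕ→ℚ q , p-bound′ , q-bound′ , l-bound′
  where
  0≤ℕ→ℚ : ∀ x → 0ℚ ℚ.≤ ℕ→ℚ x
  0≤ℕ→ℚ x = subst (ℚ._≤ ℕ→ℚ x) (ℕ→ℚ-mkℚ 0) (ℕ→ℚ-mono-≤ {0} {x} z≤n)
  ℕ→ℚ-cube : ∀ x → ℕ→ℚ x ℚ.* ℕ→ℚ x ℚ.* ℕ→ℚ x ≡ ℕ→ℚ (cube x)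
  ℕ→ℚ-cube x = trans (cong (ℚ._* ℕ→ℚ x) (ℕ→ℚ-* x x)) (ℕ→ℚ-* (x * x) x)
  p-bound′ : ℕ→ℚ 2 ℚ.* (ℕ→ℚ p ℚ.* ℕ→ℚ p ℚ.* ℕ→ℚ p) ℚ.≤ ℕ→ℚ (27 * Δ ^ 5)
  p-bound′ = subst (ℚ._≤ ℕ→ℚ (27 * Δ ^ 5)) (sym (trans (cong (ℕ→ℚ 2 ℚ.*_) (ℕ→ℚ-cube p)) (ℕ→ℚ-* 2 (cube p))))
               (ℕ→ℚ-mono-≤ p-bound)
  q-bound′ : ℕ→ℚ q ℚ.* ℕ→ℚ q ℚ.* ℕ→ℚ q ℚ.≤ ℕ→ℚ (512 * Δ ^ 4)
  q-bound′ = subst (ℚ._≤ ℕ→ℚ (512 * Δ ^ 4)) (sym (ℕ→ℚ-cube q)) (ℕ→ℚ-mono-≤ q-bound)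
  l-bound′ : ℕ→ℚ l ℚ.≤ ℕ→ℚ (Δ * Δ + 1) ℚ.+ ℕ→ℚ p ℚ.+ ℕ→ℚ q
  l-bound′ = subst (ℕ→ℚ l ℚ.≤_) (sym (trans (cong (ℚ._+ ℕ→ℚ q) (ℕ→ℚ-+ (Δ * Δ + 1) p)) (ℕ→ℚ-+ (Δ * Δ + 1 + p) q)))
               (ℕ→ℚ-mono-≤ l-bound)

record CountingParameters (Δ l : ℕ) : Set where
  field
    c : ℕ
    nonZero : NonZero c
    c≤l : c ≤ l
    series : ∀ K → scaledSeries Δ c (suc K) ≤ c ^ K * (l ∸ c)

GoodParameters : ℕ → Set
GoodParameters Δ = ∃ λ l → BelowBound Δ l × CountingParameters Δ l

series-key⇒GoodParameters : ∀ Δ d l p q → 1 ≤ d → Δ * Δ + d ≤ l →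
  2 * Δ * ((Δ * Δ + d) * (Δ * Δ + d)) ≤ (l ∸ (Δ * Δ + d)) * (d * d) →
  2 * cube p ≤ 27 * Δ ^ 5 → cube q ≤ 512 * Δ ^ 4 → l ≤ Δ * Δ + 1 + p + q → GoodParameters Δ
series-key⇒GoodParameters Δ d l p q 1≤d c≤l key p-bound q-bound l-bound =
  l , BelowBound-ℕ Δ l p q p-bound q-bound l-bound ,
  record { c = Δ * Δ + d ; nonZero = >-nonZero (<-≤-trans 1≤d (m≤n+m d (Δ * Δ))) ; c≤l = c≤l
         ; series = scaledSeries-bound Δ d l 1≤d key }

goodParameters-0 : GoodParameters 0
goodParameters-0 = series-key⇒GoodParameters 0 1 1 0 0 ≤-refl ≤-refl z≤n z≤n z≤n ≤-refl

-- c = Δ² + Δz and l = Δ² + 1 + Δv + 8g; then Δv ≤ 3·2^(-1/3)Δ^(5/3) and 8g ≤ 8Δ^(4/3).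
Admissible : ℕ → ℕ → ℕ → ℕ → Set
Admissible Δ v z g = 1 ≤ z × z ≤ v × 2 * cube v ≤ 27 * (Δ * Δ) × cube g ≤ Δ * Δ * (Δ * Δ) ×
                     2 * Δ * ((Δ + z) * (Δ + z)) ≤ (1 + Δ * (v ∸ z) + 8 * g) * (z * z)

admissible? : ∀ Δ v z g → Dec (Admissible Δ v z g)
admissible? Δ v z g = 1 ≤? z ×-dec z ≤? v ×-dec 2 * cube v ≤? 27 * (Δ * Δ) ×-dec cube g ≤? Δ * Δ * (Δ * Δ) ×-dec
                      2 * Δ * ((Δ + z) * (Δ + z)) ≤? (1 + Δ * (v ∸ z) + 8 * g) * (z * z)

Admissible⇒GoodParameters : ∀ {Δ v z g} → 1 ≤ Δ → Admissible Δ v z g → GoodParameters Δ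
Admissible⇒GoodParameters {Δ} {v} {z} {g} 1≤Δ (1≤z , z≤v , v-bound , g-bound , key) =
  series-key⇒GoodParameters Δ d l (Δ * v) (8 * g) (*-mono-≤ 1≤Δ 1≤z) (m≤m+n (Δ * Δ + d) R)
    (subst (λ r → 2 * Δ * ((Δ * Δ + d) * (Δ * Δ + d)) ≤ r * (d * d)) (sym (m+n∸m≡n (Δ * Δ + d) R)) series-key)
    p-bound q-bound (≤-reflexive l≡)
  where
  d = Δ * z
  w = v ∸ z
  R = 1 + Δ * w + 8 * g
  l = Δ * Δ + d + R
  series-key : 2 * Δ * ((Δ * Δ + d) * (Δ * Δ + d)) ≤ R * (d * d)
  series-key = subst₂ _≤_
    (solve 2 (λ D z → D :* D :* (con 2 :* D :* ((D :+ z) :* (D :+ z)))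
          := con 2 :* D :* ((D :* D :+ D :* z) :* (D :* D :+ D :* z))) refl Δ z)
    (solve 3 (λ D z R → D :* D :* (R :* (z :* z)) := R :* ((D :* z) :* (D :* z))) refl Δ z R)
    (*-monoʳ-≤ (Δ * Δ) key)
  p-bound : 2 * cube (Δ * v) ≤ 27 * Δ ^ 5
  p-bound = subst₂ _≤_
    (solve 2 (λ D v → D :* D :* D :* (con 2 :* (v :* v :* v)) := con 2 :* ((D :* v) :* (D :* v) :* (D :* v))) refl Δ v)
    (solve 1 (λ D → D :* D :* D :* (con 27 :* (D :* D)) := con 27 :* (D :^ 5)) refl Δ)
    (*-monoʳ-≤ (Δ * Δ * Δ) v-bound)
  q-bound : cube (8 * g) ≤ 512 * Δ ^ 4
  q-bound = subst₂ _≤_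
    (solve 1 (λ g → con 512 :* (g :* g :* g) := (con 8 :* g) :* (con 8 :* g) :* (con 8 :* g)) refl g)
    (solve 1 (λ D → con 512 :* (D :* D :* (D :* D)) := con 512 :* (D :^ 4)) refl Δ)
    (*-monoʳ-≤ 512 g-bound)
  l≡ : l ≡ Δ * Δ + 1 + Δ * v + 8 * g
  l≡ = trans (solve 4 (λ D a b g → D :* D :+ a :+ (con 1 :+ b :+ con 8 :* g)
        := D :* D :+ con 1 :+ (a :+ b) :+ con 8 :* g) refl Δ d (Δ * w) g)
             (cong (λ t → Δ * Δ + 1 + t + 8 * g) (trans (sym (*-distribˡ-+ Δ z w)) (cong (Δ *_) (m+[n∸m]≡n z≤v))))

-- For increasing f, the largest x with f x ≤ N, found by upward search.
floorInverse : (ℕ → ℕ) → ℕ → ℕ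
floorInverse f N = search N 0
  where
  search : ℕ → ℕ → ℕ
  search zero x = x
  search (suc fuel) x = if f (suc x) ≤ᵇ N then search fuel (suc x) else x

-- For small Δ, v is taken maximal with 2v³ ≤ 27Δ² instead of ⌊3z/2⌋.
small-v small-z small-g : ℕ → ℕ
small-v Δ = floorInverse (λ x → 2 * cube x) (27 * (Δ * Δ))
small-z Δ = floorInverse cube (4 * (Δ * Δ))
small-g Δ = floorInverse cube (Δ * Δ * (Δ * Δ))

admissible-small? : ∀ Δ → Dec (Admissible Δ (small-v Δ) (small-z Δ) (small-g Δ))
admissible-small? Δ = admissible? Δ (small-v Δ) (small-z Δ) (small-g Δ)

T-∧⁻ : ∀ {x y} → T (x ∧ y) → T x × T y
T-∧⁻ {x} {y} = Equivalence.to (T-∧ {x} {y})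

all-admissible-below : ℕ → Bool
all-admissible-below zero = true
all-admissible-below (suc n) = isYes (admissible-small? (suc n)) ∧ all-admissible-below n

all-admissible-below-31 : T (all-admissible-below 31)
all-admissible-below-31 = _

admissible-small : ∀ {Δ} → 1 ≤ Δ → Δ ≤ 31 → Admissible Δ (small-v Δ) (small-z Δ) (small-g Δ)
admissible-small {Δ} 1≤Δ Δ≤31 = toWitness (extract 31 all-admissible-below-31 Δ≤31)
  where
  extract : ∀ n → T (all-admissible-below n) → Δ ≤ n → True (admissible-small? Δ)
  extract zero _ Δ≤0 = ⊥-elim (<⇒≱ 1≤Δ Δ≤0)
  extract (suc n) all-ok Δ≤1+n with T-∧⁻ {isYes (admissible-small? (suc n))} all-ok | m≤n⇒m<n∨m≡n Δ≤1+n
  ... | suc-n-ok , _ | inj₂ refl = suc-n-ok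
  ... | _ , below-ok | inj₁ (s≤s Δ≤n) = extract n below-ok Δ≤n

goodParameters-small : ∀ Δ → 1 ≤ Δ → Δ ≤ 31 → GoodParameters Δ
goodParameters-small Δ 1≤Δ Δ≤31 =
  Admissible⇒GoodParameters {Δ} {small-v Δ} {small-z Δ} {small-g Δ} 1≤Δ (admissible-small 1≤Δ Δ≤31)

cube-mono-≤ : ∀ {a b} → a ≤ b → cube a ≤ cube b
cube-mono-≤ a≤b = *-mono-≤ (*-mono-≤ a≤b a≤b) a≤b

cube-mono-< : ∀ {a b} → a < b → cube a < cube b
cube-mono-< a<b = *-mono-< (*-mono-< a<b a<b) a<b

cube-cancel-≤ : ∀ {a b} → cube a ≤ cube b → a ≤ b
cube-cancel-≤ {a} {b} a³≤b³ with a ≤? b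
... | yes a≤b = a≤b
... | no a≰b = ⊥-elim (<⇒≱ (cube-mono-< (≰⇒> a≰b)) a³≤b³)

cube-cancel-< : ∀ {a b} → cube a < cube b → a < b
cube-cancel-< {a} {b} a³<b³ with suc a ≤? b
... | yes a<b = a<b
... | no a≮b = ⊥-elim (<⇒≱ a³<b³ (cube-mono-≤ (≤-pred (≰⇒> a≮b))))

cube-root : ∀ N → ∃ λ x → cube x ≤ N × N < cube (suc x)
cube-root zero = 0 , z≤n , s≤s z≤n
cube-root (suc N) with cube-root N
... | x , x³≤N , N<[x+1]³ with cube (suc x) ≤? suc N
... | yes [x+1]³≤1+N = suc x , [x+1]³≤1+N ,
        subst (_< cube (suc (suc x))) (≤-antisym [x+1]³≤1+N N<[x+1]³) (cube-mono-< {suc x} {suc (suc x)} ≤-refl)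
... | no [x+1]³≰1+N = x , m≤n⇒m≤1+n x³≤N , ≰⇒> [x+1]³≰1+N

half : ∀ a → ∃ λ v → v + v ≤ a × a ≤ suc (v + v)
half zero = 0 , z≤n , z≤n
half (suc zero) = 0 , z≤n , ≤-refl
half (suc (suc a)) with half a
... | v , 2v≤a , a≤2v+1 =
  suc v , subst (_≤ suc (suc a)) 2+2v≡ (s≤s (s≤s 2v≤a)) , subst (suc (suc a) ≤_) (cong suc 2+2v≡) (s≤s (s≤s a≤2v+1))
  where
  2+2v≡ : suc (suc (v + v)) ≡ suc v + suc v
  2+2v≡ = cong suc (sym (+-suc v v))

m+m≤n+n⇒m≤n : ∀ {m n} → m + m ≤ n + n → m ≤ n
m+m≤n+n⇒m≤n {m} {n} m+m≤n+n with m ≤? n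
... | yes m≤n = m≤n
... | no m≰n = ⊥-elim (<⇒≱ (+-mono-< (≰⇒> m≰n) (≰⇒> m≰n)) m+m≤n+n)

-- For Δ ≥ 32 take z = ⌊(4Δ²)^(1/3)⌋, g = ⌊Δ^(4/3)⌋ and v = ⌊3z/2⌋.
module Large (Δ z g v : ℕ) (32≤Δ : 32 ≤ Δ)
  (z³≤4Δ² : cube z ≤ 4 * (Δ * Δ)) (4Δ²<[z+1]³ : 4 * (Δ * Δ) < cube (suc z))
  (g³≤Δ⁴ : cube g ≤ Δ * Δ * (Δ * Δ)) (Δ⁴<[g+1]³ : Δ * Δ * (Δ * Δ) < cube (suc g))
  (2v≤3z : v + v ≤ 3 * z) (3z≤2v+1 : 3 * z ≤ suc (v + v)) where

  open ≤-Reasoning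

  1≤Δ : 1 ≤ Δ
  1≤Δ = ≤-trans (s≤s z≤n) 32≤Δ

  1≤z : 1 ≤ z
  1≤z = positive z 4Δ²<[z+1]³
    where
    positive : ∀ x → 4 * (Δ * Δ) < cube (suc x) → 1 ≤ x
    positive (suc _) _ = s≤s z≤n
    positive zero 4Δ²<1 = ⊥-elim (<⇒≱ 4Δ²<1 (≤-trans (s≤s z≤n) (*-monoʳ-≤ 4 (*-mono-≤ 1≤Δ 1≤Δ))))

  z≤v : z ≤ v
  z≤v = m+m≤n+n⇒m≤n (≤-pred (begin
    suc (z + z)   ≤⟨ +-monoˡ-≤ (z + z) 1≤z ⟩
    z + (z + z)   ≡⟨ solve 1 (λ z → z :+ (z :+ z) := con 3 :* z) refl z ⟩
    3 * z         ≤⟨ 3z≤2v+1 ⟩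
    suc (v + v)   ∎))

  2v³≤27Δ² : 2 * cube v ≤ 27 * (Δ * Δ)
  2v³≤27Δ² = *-cancelˡ-≤ 4 (begin
    4 * (2 * cube v)      ≡⟨ solve 1 (λ v → con 4 :* (con 2 :* (v :* v :* v)) := (v :+ v) :* (v :+ v) :* (v :+ v)) refl v ⟩
    cube (v + v)          ≤⟨ cube-mono-≤ 2v≤3z ⟩
    cube (3 * z)          ≡⟨ solve 1 (λ z → (con 3 :* z) :* (con 3 :* z) :* (con 3 :* z) := con 27 :* (z :* z :* z)) refl z ⟩
    27 * cube z           ≤⟨ *-monoʳ-≤ 27 z³≤4Δ² ⟩
    27 * (4 * (Δ * Δ))    ≡⟨ solve 1 (λ D → con 27 :* (con 4 :* (D :* D)) := con 4 :* (con 27 :* (D :* D))) refl Δ ⟩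
    4 * (27 * (Δ * Δ))    ∎)

  w = v ∸ z
  R = 1 + Δ * w + 8 * g

  v≡z+w : v ≡ z + w
  v≡z+w = sym (m+[n∸m]≡n z≤v)

  z≤1+2w : z ≤ suc (w + w)
  z≤1+2w = +-cancelˡ-≤ (z + z) _ _ (begin
    z + z + z               ≡⟨ solve 1 (λ z → z :+ z :+ z := con 3 :* z) refl z ⟩
    3 * z                   ≤⟨ 3z≤2v+1 ⟩
    suc (v + v)             ≡⟨ cong (λ t → suc (t + t)) v≡z+w ⟩
    suc ((z + w) + (z + w)) ≡⟨ solve 2 (λ z w → con 1 :+ ((z :+ w) :+ (z :+ w)) := z :+ z :+ (con 1 :+ (w :+ w))) refl z w ⟩
    z + z + suc (w + w)     ∎)

  2z≤Δ : 2 * z ≤ Δ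
  2z≤Δ = cube-cancel-≤ (begin
    cube (2 * z)        ≡⟨ solve 1 (λ z → (con 2 :* z) :* (con 2 :* z) :* (con 2 :* z) := con 8 :* (z :* z :* z)) refl z ⟩
    8 * cube z          ≤⟨ *-monoʳ-≤ 8 z³≤4Δ² ⟩
    8 * (4 * (Δ * Δ))   ≡⟨ solve 1 (λ D → con 8 :* (con 4 :* (D :* D)) := con 32 :* (D :* D)) refl Δ ⟩
    32 * (Δ * Δ)        ≤⟨ *-monoˡ-≤ (Δ * Δ) 32≤Δ ⟩
    Δ * (Δ * Δ)         ≡⟨ sym (*-assoc Δ Δ Δ) ⟩
    cube Δ              ∎)

  8g≤Δ² : 8 * g ≤ Δ * Δ
  8g≤Δ² = cube-cancel-≤ (begin
    cube (8 * g)                  ≡⟨ solve 1 (λ g → (con 8 :* g) :* (con 8 :* g) :* (con 8 :* g) := con 512 :* (g :* g :* g)) refl g ⟩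
    512 * cube g                  ≤⟨ *-monoʳ-≤ 512 g³≤Δ⁴ ⟩
    512 * (Δ * Δ * (Δ * Δ))       ≤⟨ *-monoˡ-≤ (Δ * Δ * (Δ * Δ)) (≤-trans (m≤m+n 512 512) (*-mono-≤ 32≤Δ 32≤Δ)) ⟩
    Δ * Δ * (Δ * Δ * (Δ * Δ))     ≡⟨ solve 1 (λ D → D :* D :* (D :* D :* (D :* D)) := (D :* D) :* (D :* D) :* (D :* D)) refl Δ ⟩
    cube (Δ * Δ)                  ∎)

  3Δ²<2[g+1][z+1] : 3 * (Δ * Δ) < 2 * (suc g * suc z)
  3Δ²<2[g+1][z+1] = cube-cancel-< (begin-strict
    cube (3 * (Δ * Δ))                   ≡⟨ solve 1 (λ D → (con 3 :* (D :* D)) :* (con 3 :* (D :* D)) :* (con 3 :* (D :* D))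
          := con 27 :* (D :* D :* (D :* D) :* (D :* D))) refl Δ ⟩
    27 * (Δ * Δ * (Δ * Δ) * (Δ * Δ))     ≤⟨ *-monoˡ-≤ (Δ * Δ * (Δ * Δ) * (Δ * Δ)) (m≤m+n 27 5) ⟩
    32 * (Δ * Δ * (Δ * Δ) * (Δ * Δ))     ≡⟨ solve 1 (λ D → con 32 :* (D :* D :* (D :* D) :* (D :* D))
          := con 8 :* ((D :* D :* (D :* D)) :* (con 4 :* (D :* D)))) refl Δ ⟩
    8 * ((Δ * Δ * (Δ * Δ)) * (4 * (Δ * Δ)))  <⟨ *-monoʳ-< 8 (*-mono-< Δ⁴<[g+1]³ 4Δ²<[z+1]³) ⟩
    8 * (cube (suc g) * cube (suc z))    ≡⟨ solve 2 (λ a b → con 8 :* ((a :* a :* a) :* (b :* b :* b))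
          := (con 2 :* (a :* b)) :* (con 2 :* (a :* b)) :* (con 2 :* (a :* b))) refl (suc g) (suc z) ⟩
    cube (2 * (suc g * suc z))           ∎)

  3Δz+4g+4z+2≤4Δ² : 3 * (Δ * z) + 4 * g + 4 * z + 2 ≤ 4 * (Δ * Δ)
  3Δz+4g+4z+2≤4Δ² = *-cancelˡ-≤ 2 (begin
    2 * (3 * (Δ * z) + 4 * g + 4 * z + 2)
      ≡⟨ solve 3 (λ D z g → con 2 :* (con 3 :* (D :* z) :+ con 4 :* g :+ con 4 :* z :+ con 2)
            := con 3 :* (D :* (con 2 :* z)) :+ con 8 :* g :+ con 4 :* (con 2 :* z) :+ con 4) refl Δ z g ⟩
    3 * (Δ * (2 * z)) + 8 * g + 4 * (2 * z) + 4
      ≤⟨ +-monoˡ-≤ 4 (+-mono-≤ (+-mono-≤ (*-monoʳ-≤ 3 (*-monoʳ-≤ Δ 2z≤Δ)) 8g≤Δ²) (*-monoʳ-≤ 4 2z≤Δ)) ⟩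
    3 * (Δ * Δ) + Δ * Δ + 4 * Δ + 4
      ≤⟨ ≤-reflexive (solve 1 (λ D → con 3 :* (D :* D) :+ D :* D :+ con 4 :* D :+ con 4
            := con 4 :* (D :* D) :+ con 4 :* (D :+ con 1)) refl Δ) ⟩
    4 * (Δ * Δ) + 4 * (Δ + 1)
      ≤⟨ +-monoʳ-≤ (4 * (Δ * Δ)) (*-monoʳ-≤ 4 Δ+1≤Δ²) ⟩
    4 * (Δ * Δ) + 4 * (Δ * Δ)
      ≡⟨ solve 1 (λ D → con 4 :* (D :* D) :+ con 4 :* (D :* D) := con 2 :* (con 4 :* (D :* D))) refl Δ ⟩
    2 * (4 * (Δ * Δ)) ∎)
    where
    Δ+1≤Δ² : Δ + 1 ≤ Δ * Δ
    Δ+1≤Δ² = begin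
      Δ + 1       ≤⟨ +-monoʳ-≤ Δ 1≤Δ ⟩
      Δ + Δ       ≡⟨ solve 1 (λ D → D :+ D := D :* con 2) refl Δ ⟩
      Δ * 2       ≤⟨ *-monoʳ-≤ Δ (≤-trans (m≤m+n 2 30) 32≤Δ) ⟩
      Δ * Δ       ∎

  2Δ²+3Δz≤4gz : 2 * (Δ * Δ) + 3 * (Δ * z) ≤ 4 * g * z
  2Δ²+3Δz≤4gz = +-cancelʳ-≤ (4 * g + 4 * z + 4) _ _ (begin
    2 * (Δ * Δ) + 3 * (Δ * z) + (4 * g + 4 * z + 4)
      ≡⟨ solve 3 (λ D z g → con 2 :* (D :* D) :+ con 3 :* (D :* z) :+ (con 4 :* g :+ con 4 :* z :+ con 4)
            := con 2 :* (D :* D) :+ (con 3 :* (D :* z) :+ con 4 :* g :+ con 4 :* z :+ con 2) :+ con 2) refl Δ z g ⟩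
    2 * (Δ * Δ) + (3 * (Δ * z) + 4 * g + 4 * z + 2) + 2
      ≤⟨ +-monoˡ-≤ 2 (+-monoʳ-≤ (2 * (Δ * Δ)) 3Δz+4g+4z+2≤4Δ²) ⟩
    2 * (Δ * Δ) + 4 * (Δ * Δ) + 2
      ≡⟨ solve 1 (λ D → con 2 :* (D :* D) :+ con 4 :* (D :* D) :+ con 2 := con 2 :* (con 1 :+ con 3 :* (D :* D))) refl Δ ⟩
    2 * suc (3 * (Δ * Δ))
      ≤⟨ *-monoʳ-≤ 2 3Δ²<2[g+1][z+1] ⟩
    2 * (2 * (suc g * suc z))
      ≡⟨ solve 2 (λ g z → con 2 :* (con 2 :* ((con 1 :+ g) :* (con 1 :+ z)))
            := con 4 :* g :* z :+ (con 4 :* g :+ con 4 :* z :+ con 4)) refl g z ⟩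
    4 * g * z + (4 * g + 4 * z + 4) ∎)

  3Δz+Δ≤4Δz² : 3 * (Δ * z) + Δ ≤ 4 * (Δ * (z * z))
  3Δz+Δ≤4Δz² = begin
    3 * (Δ * z) + Δ                     ≤⟨ +-mono-≤ (*-monoʳ-≤ 3 (*-monoʳ-≤ Δ (m≤m*n z z))) (m≤m*n Δ (z * z) {{m*n≢0 z z}}) ⟩
    3 * (Δ * (z * z)) + Δ * (z * z)     ≡⟨ solve 2 (λ D q → con 3 :* (D :* q) :+ D :* q := con 4 :* (D :* q)) refl Δ (z * z) ⟩
    4 * (Δ * (z * z))                   ∎
    where
    instance
      z≢0 : NonZero z
      z≢0 = >-nonZero 1≤z

  key : 2 * Δ * ((Δ + z) * (Δ + z)) ≤ R * (z * z)
  key = *-cancelˡ-≤ 2 (begin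
    2 * (2 * Δ * ((Δ + z) * (Δ + z)))
      ≡⟨ solve 2 (λ D z → con 2 :* (con 2 :* D :* ((D :+ z) :* (D :+ z)))
            := D :* (con 4 :* (D :* D)) :+ (con 8 :* (D :* D) :* z :+ con 4 :* D :* (z :* z))) refl Δ z ⟩
    Δ * (4 * (Δ * Δ)) + (8 * (Δ * Δ) * z + 4 * Δ * (z * z))
      ≤⟨ +-monoˡ-≤ _ (*-monoʳ-≤ Δ (<⇒≤ 4Δ²<[z+1]³)) ⟩
    Δ * cube (suc z) + (8 * (Δ * Δ) * z + 4 * Δ * (z * z))
      ≡⟨ solve 2 (λ D z → D :* ((con 1 :+ z) :* (con 1 :+ z) :* (con 1 :+ z)) :+ (con 8 :* (D :* D) :* z :+ con 4 :* D :* (z :* z))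
                             := D :* z :* (z :* z) :+ (con 3 :* (D :* (z :* z)) :+ (con 3 :* (D :* z) :+ D) :+ (con 8 :* (D :* D) :* z :+ con 4 :* D :* (z :* z)))) refl Δ z ⟩
    Δ * z * (z * z) + (3 * (Δ * (z * z)) + (3 * (Δ * z) + Δ) + (8 * (Δ * Δ) * z + 4 * Δ * (z * z)))
      ≤⟨ +-monoˡ-≤ _ (subst₂ _≤_ (sym (*-assoc Δ z (z * z))) (sym (*-assoc Δ (suc (w + w)) (z * z))) (*-monoʳ-≤ Δ (*-monoˡ-≤ (z * z) z≤1+2w))) ⟩
    Δ * suc (w + w) * (z * z) + (3 * (Δ * (z * z)) + (3 * (Δ * z) + Δ) + (8 * (Δ * Δ) * z + 4 * Δ * (z * z)))
      ≡⟨ solve 4 (λ D z w t → D :* (con 1 :+ (w :+ w)) :* (z :* z) :+ (con 3 :* (D :* (z :* z)) :+ t :+ (con 8 :* (D :* D) :* z :+ con 4 :* D :* (z :* z)))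
                               := con 2 :* D :* w :* (z :* z) :+ con 8 :* (D :* (z :* z)) :+ t :+ con 8 :* (D :* D) :* z) refl Δ z w (3 * (Δ * z) + Δ) ⟩
    2 * Δ * w * (z * z) + 8 * (Δ * (z * z)) + (3 * (Δ * z) + Δ) + 8 * (Δ * Δ) * z
      ≤⟨ +-monoˡ-≤ (8 * (Δ * Δ) * z) (+-monoʳ-≤ (2 * Δ * w * (z * z) + 8 * (Δ * (z * z))) 3Δz+Δ≤4Δz²) ⟩
    2 * Δ * w * (z * z) + 8 * (Δ * (z * z)) + 4 * (Δ * (z * z)) + 8 * (Δ * Δ) * z
      ≡⟨ solve 3 (λ D z w → con 2 :* D :* w :* (z :* z) :+ con 8 :* (D :* (z :* z)) :+ con 4 :* (D :* (z :* z)) :+ con 8 :* (D :* D) :* z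
                       := con 2 :* D :* w :* (z :* z) :+ con 4 :* z :* (con 2 :* (D :* D) :+ con 3 :* (D :* z))) refl Δ z w ⟩
    2 * Δ * w * (z * z) + 4 * z * (2 * (Δ * Δ) + 3 * (Δ * z))
      ≤⟨ +-monoʳ-≤ _ (*-monoʳ-≤ (4 * z) 2Δ²+3Δz≤4gz) ⟩
    2 * Δ * w * (z * z) + 4 * z * (4 * g * z)
      ≤⟨ m≤n+m _ (2 * (z * z)) ⟩
    2 * (z * z) + (2 * Δ * w * (z * z) + 4 * z * (4 * g * z))
      ≡⟨ solve 4 (λ D z w g → con 2 :* (z :* z) :+ (con 2 :* D :* w :* (z :* z) :+ con 4 :* z :* (con 4 :* g :* z))
                         := con 2 :* ((con 1 :+ D :* w :+ con 8 :* g) :* (z :* z))) refl Δ z w g ⟩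
    2 * (R * (z * z)) ∎)

  admissible : Admissible Δ v z g
  admissible = 1≤z , z≤v , 2v³≤27Δ² , g³≤Δ⁴ , key

goodParameters-large : ∀ Δ → 32 ≤ Δ → GoodParameters Δ
goodParameters-large Δ 32≤Δ =
  let z , z³≤4Δ² , 4Δ²<[z+1]³ = cube-root (4 * (Δ * Δ))
      g , g³≤Δ⁴ , Δ⁴<[g+1]³ = cube-root (Δ * Δ * (Δ * Δ))
      v , 2v≤3z , 3z≤2v+1 = half (3 * z)
      open Large Δ z g v 32≤Δ z³≤4Δ² 4Δ²<[z+1]³ g³≤Δ⁴ Δ⁴<[g+1]³ 2v≤3z 3z≤2v+1
  in Admissible⇒GoodParameters {Δ} {v} {z} {g} 1≤Δ admissible

goodParameters : ∀ Δ → GoodParameters Δ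
goodParameters zero = goodParameters-0
goodParameters Δ@(suc _) = by-size (Δ ≤? 31)
  where
  by-size : Dec (Δ ≤ 31) → GoodParameters Δ
  by-size (yes Δ≤31) = goodParameters-small Δ (s≤s z≤n) Δ≤31
  by-size (no Δ≰31) = goodParameters-large Δ (≰⇒> Δ≰31)

corollary1 : (G : Graph) (Δ : ℕ) → MaxDegree G Δ →
    ∃[ l ] (BelowBound Δ l × ChoosableWith G l)
corollary1 G Δ (degΔ , _) =
  let l , below , parameters = goodParameters Δ
      open CountingParameters parameters
  in l , below , λ L L-unique L-long → Counting.Growth.choosable G L L-unique degΔ L-long c {{nonZero}} c≤l series
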